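{- Let $H$ be a bipartite graph with no vertex of degree zero or one and vertex set $S\uplus T$, $S=\{1,\dots,n\}$, $T=\{n+1,\dots,n+m\}$. Let $\mathbf{a},\mathbf{b}$ be clique vectors of $H$. Then $\phi(\mathbf{a})\lessdot\phi(\mathbf{b})$ in the framing poset if and only if exactly one of the following holds: (1) $\mathbf{a}$ and $\mathbf{b}$ differ in exactly one entry $a_i\ne b_i$, where $i\in\{1,\dots,n\}$, $a_i=j$ and $a_j\ne i$, and $b_i$ is the largest neighbor of $i$ less than $j$; (2) $\mathbf{a}$ and $\mathbf{b}$ differ in exactly one entry $a_j\ne b_j$, where $j\in\{n+1,\dots,n+m\}$, $a_i\ne j$ and $a_j=i$, and $b_j$ is the smallest neighbor of $j$ greater than $i$; (3) $\mathbf{a}$ and $\mathbf{b}$ differ only in that $a_{i,j}=-$ while $b_{i,j}=+$; (4) $\mathbf{a}$ and $\mathbf{b}$ differ in exactly two entries, as follows: $a_{i,j}=+$ while $b_{i,j}=-$, and either $b_i$ is the largest neighbor of $i$ that is less than $j$ or $b_j$ is the smallest neighbor of $j$ that is greater than $i$.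
   Context: Every edge of $H$ joins $S$ to $T$; edges are written $ij$ with $i\in S$, $j\in T$. The extension $G(H)$ is obtained from $H$ (directed from $S$ to $T$) by adding vertices $s,t$, parallel edges $\alpha_{1,i},\alpha_{2,i}$ from $s$ to each $i\in S$, an edge $\beta_{i,j}$ for each edge $ij$ of $H$, and parallel edges $\gamma_{j,1},\gamma_{j,2}$ from each $j\in T$ to $t$. Routes are $s$–$t$ paths, all of the form $\alpha_{a,i}\beta_{i,j}\gamma_{j,b}$. Under the canonical bipartite framing ($\alpha_{1,i}<\alpha_{2,i}$, $\gamma_{j,1}<\gamma_{j,2}$, $\beta_{i,j}<\beta_{i,k}$ if $j<k$, $\beta_{j,i}<\beta_{k,i}$ if $j<k$), a route $R_1$ is clockwise from a route $R_2$ (and they are incoherent) exactly when, for some indices, either $R_1=\alpha_{1,i}\beta_{i,j}\gamma_{j,2}$ and $R_2=\alpha_{2,i}\beta_{i,j}\gamma_{j,1}$; or $R_1=\alpha_{1,i}\beta_{i,k}\gamma_{k,b}$ and $R_2=\alpha_{2,i}\beta_{i,j}\gamma_{j,b'}$ with $j<k$; or $R_1=\alpha_{a,i}\beta_{i,j}\gamma_{j,2}$ and $R_2=\alpha_{a',i'}\beta_{i',j}\gamma_{j,1}$ with $i<i'$. Two routes are coherent iff neither is clockwise from the other. A clique is a set of pairwise coherent routes; $\mathcal{C}(H)$ is the set of maximal cliques. For $C_1,C_2\in\mathcal{C}(H)$, $C_2$ is obtained from $C_1$ by a counterclockwise rotation if $C_2=(C_1\setminus\{R_1\})\cup\{R_2\}$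 with $R_1$ clockwise from $R_2$; the framing poset (framing lattice) on $\mathcal{C}(H)$ is the partial order in which $C_1\le C_2$ iff $C_2$ is obtained from $C_1$ by a finite sequence of counterclockwise rotations, and $\lessdot$ is its cover relation. A clique vector is $\mathbf{a}=((a_v)_{v\in S\cup T},(a_{i,j})_{ij\in E(H)})$ with $a_v\in N_H(v)$ and $a_{i,j}\in\{+,-\}$, where $a_{i,j}=+$ is allowed only if $a_i=j$ and $a_j=i$. The clique map $\phi$ sends $\mathbf{a}$ to the set of routes containing, for each edge $ij$: (i) if $a_i\ne j$ and $a_j\ne i$: the route $\alpha_{x,i}\beta_{i,j}\gamma_{j,y}$ with $x=2$ if $a_i<j$, $x=1$ if $a_i>j$, $y=2$ if $a_j<i$, $y=1$ if $a_j>i$; (ii) if $a_i=j$, $a_j<i$: $\alpha_{1,i}\beta_{i,j}\gamma_{j,2},\alpha_{2,i}\beta_{i,j}\gamma_{j,2}$; if $a_i=j$, $a_j>i$: $\alpha_{1,i}\beta_{i,j}\gamma_{j,1},\alpha_{2,i}\beta_{i,j}\gamma_{j,1}$; if $a_j=i$, $a_i<j$: $\alpha_{2,i}\beta_{i,j}\gamma_{j,1},\alpha_{2,i}\beta_{i,j}\gamma_{j,2}$; if $a_j=i$, $a_i>j$: $\alpha_{1,i}\beta_{i,j}\gamma_{j,1},\alpha_{1,i}\beta_{i,j}\gamma_{j,2}$; (iii) if $a_i=j$, $a_j=i$: for $a_{i,j}=-$ the routes $\alpha_{1,i}\beta_{i,j}\gamma_{j,1},\alpha_{1,i}\beta_{i,j}\gamma_{j,2},\alpha_{2,i}\beta_{i,j}\gamma_{j,2}$,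 and for $a_{i,j}=+$ the routes $\alpha_{1,i}\beta_{i,j}\gamma_{j,1},\alpha_{2,i}\beta_{i,j}\gamma_{j,1},\alpha_{2,i}\beta_{i,j}\gamma_{j,2}$. The map $\phi$ is a bijection from clique vectors to $\mathcal{C}(H)$. -}

module Defs where

open import Data.Nat using (ℕ; _≤_)
open import Data.Fin using (Fin; _<?_; _≟_) renaming (_<_ to _<F_; _≤_ to _≤F_)
open import Data.Bool using (Bool; true; false; T; if_then_else_; _∧_; not)
open import Data.List using (length; filterᵇ; allFin)
open import Data.Product using (Σ; _×_; ∃; ∃-syntax; _,_)
open import Data.Sum using (_⊎_)
open import Relation.Nullary using (¬_; Dec; yes; no; does)
open import Relation.Binary.PropositionalEquality using (_≡_; _≢_)
open import Function.Bundles using (_⇔_)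

-- S is modelled by Fin n, T by Fin m (T-vertex k ↔ n+1+k), with the
-- orders induced by the labels.

record BipGraph : Set where
  field
    n   : ℕ
    m   : ℕ
    adj : Fin n → Fin m → Bool

module _ (H : BipGraph) where
  open BipGraph H

  Edge : Fin n → Fin m → Set
  Edge i j = T (adj i j)

  degS : Fin n → ℕ
  degS i = length (filterᵇ (λ j → adj i j) (allFin m))

  degT : Fin m → ℕ
  degT j = length (filterᵇ (λ i → adj i j) (allFin n))

  NoSmallDegree : Set
  NoSmallDegree = (∀ i → 2 ≤ degS i) × (∀ j → 2 ≤ degT j)

-- Routes of G(H): α_{x,i} β_{i,j} γ_{j,y}

data Two : Set where
  ₁ ₂ : Two

_≟₂_ : Two → Two → Bool
₁ ≟₂ ₁ = true
₂ ≟₂ ₂ = true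
_ ≟₂ _ = false

module _ (H : BipGraph) where
  open BipGraph H

  record Route : Set where
    constructor route
    field
      src  : Two      -- x in α_{x,i}
      rs   : Fin n
      rt   : Fin m
      tgt  : Two      -- y in γ_{j,y}
      edge : Edge H rs rt

  open Route

  -- R₁ is clockwise from R₂ (canonical bipartite framing)
  data Clockwise (R₁ R₂ : Route) : Set where
    cw-same : rs R₁ ≡ rs R₂ → rt R₁ ≡ rt R₂ →
              src R₁ ≡ ₁ → tgt R₁ ≡ ₂ → src R₂ ≡ ₂ → tgt R₂ ≡ ₁ →
              Clockwise R₁ R₂
    cw-S    : rs R₁ ≡ rs R₂ → rt R₂ <F rt R₁ →
              src R₁ ≡ ₁ → src R₂ ≡ ₂ →
              Clockwise R₁ R₂
    cw-T    : rt R₁ ≡ rt R₂ → rs R₁ <F rs R₂ →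
              tgt R₁ ≡ ₂ → tgt R₂ ≡ ₁ →
              Clockwise R₁ R₂

  Coherent : Route → Route → Set
  Coherent R₁ R₂ = ¬ Clockwise R₁ R₂ × ¬ Clockwise R₂ R₁

  RSet : Set
  RSet = Route → Bool

  _∈R_ : Route → RSet → Set
  R ∈R C = T (C R)

  _⊆R_ : RSet → RSet → Set
  C ⊆R D = ∀ R → R ∈R C → R ∈R D

  _≐_ : RSet → RSet → Set
  C ≐ D = ∀ R → C R ≡ D R

  IsClique : RSet → Set
  IsClique C = ∀ R₁ R₂ → R₁ ∈R C → R₂ ∈R C → Coherent R₁ R₂

  IsMaxClique : RSet → Set
  IsMaxClique C = IsClique C × (∀ D → IsClique D → C ⊆R D → D ⊆R C)

  Rotation : RSet → RSet → Set
  Rotation C₁ C₂ =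
    IsMaxClique C₁ × IsMaxClique C₂ ×
    Σ Route λ R₁ → Σ Route λ R₂ → Clockwise R₁ R₂ ×
      (∀ R → (R ∈R C₂) ⇔ ((R ∈R C₁ × R ≢ R₁) ⊎ R ≡ R₂))

  data _≤fr_ : RSet → RSet → Set where
    done : ∀ {C₁ C₂} → C₁ ≐ C₂ → C₁ ≤fr C₂
    step : ∀ {C₁ C C₂} → Rotation C₁ C → C ≤fr C₂ → C₁ ≤fr C₂

  _⋖_ : RSet → RSet → Set
  C₁ ⋖ C₂ = C₁ ≤fr C₂ × ¬ (C₁ ≐ C₂) ×
    (∀ C → IsMaxClique C → C₁ ≤fr C → C ≤fr C₂ → C ≐ C₁ ⊎ C ≐ C₂)

data Sign : Set where
  plus minus : Sign

module _ (H : BipGraph) where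
  open BipGraph H

  record CliqueVector : Set where
    field
      aS    : Fin n → Fin m
      aS-nb : ∀ i → Edge H i (aS i)
      aT    : Fin m → Fin n
      aT-nb : ∀ j → Edge H (aT j) j
      sg    : Fin n → Fin m → Sign
      -- a_{i,j} = + only if a_i = j and a_j = i (forces a_{i,j} = - off edges)
      sg-ok : ∀ i j → sg i j ≡ plus → aS i ≡ j × aT j ≡ i

  open CliqueVector

  φ : CliqueVector → RSet H
  φ a (route x i j y _) with does (aS a i ≟ j) | does (aT a j ≟ i)
  ... | false | false =
        (x ≟₂ (if does (aS a i <? j) then ₂ else ₁)) ∧
        (y ≟₂ (if does (aT a j <? i) then ₂ else ₁))
  ... | true | false = y ≟₂ (if does (aT a j <? i) then ₂ else ₁)
  ... | false | true = x ≟₂ (if does (aS a i <? j) then ₂ else ₁)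
  ... | true | true with sg a i j
  ...   | minus = not ((x ≟₂ ₂) ∧ (y ≟₂ ₁))
  ...   | plus  = not ((x ≟₂ ₁) ∧ (y ≟₂ ₂))

  data Entry : Set where
    eS : Fin n → Entry
    eT : Fin m → Entry
    eE : Fin n → Fin m → Entry

  DiffersAt : CliqueVector → CliqueVector → Entry → Set
  DiffersAt a b (eS i)   = aS a i ≢ aS b i
  DiffersAt a b (eT j)   = aT a j ≢ aT b j
  DiffersAt a b (eE i j) = sg a i j ≢ sg b i j

  DifferExactlyAt : CliqueVector → CliqueVector → (Entry → Set) → Set
  DifferExactlyAt a b P = ∀ e → DiffersAt a b e ⇔ P e

  LargestNbrBelow : Fin n → Fin m → Fin m → Set
  LargestNbrBelow i j k =
    Edge H i k × k <F j × (∀ k' → Edge H i k' → k' <F j → k' ≤F k)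

  SmallestNbrAbove : Fin m → Fin n → Fin n → Set
  SmallestNbrAbove j i k =
    Edge H k j × i <F k × (∀ k' → Edge H k' j → i <F k' → k ≤F k')

  Cond1 : CliqueVector → CliqueVector → Set
  Cond1 a b = ∃[ i ] ∃[ j ]
    DifferExactlyAt a b (λ e → e ≡ eS i) ×
    aS a i ≡ j × aT a j ≢ i × LargestNbrBelow i j (aS b i)

  Cond2 : CliqueVector → CliqueVector → Set
  Cond2 a b = ∃[ i ] ∃[ j ]
    DifferExactlyAt a b (λ e → e ≡ eT j) ×
    aS a i ≢ j × aT a j ≡ i × SmallestNbrAbove j i (aT b j)

  Cond3 : CliqueVector → CliqueVector → Set
  Cond3 a b = ∃[ i ] ∃[ j ]
    DifferExactlyAt a b (λ e → e ≡ eE i j) ×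
    sg a i j ≡ minus × sg b i j ≡ plus

  Cond4 : CliqueVector → CliqueVector → Set
  Cond4 a b = ∃[ i ] ∃[ j ]
    sg a i j ≡ plus × sg b i j ≡ minus ×
    ( (DifferExactlyAt a b (λ e → e ≡ eE i j ⊎ e ≡ eS i) ×
       LargestNbrBelow i j (aS b i))
    ⊎ (DifferExactlyAt a b (λ e → e ≡ eE i j ⊎ e ≡ eT j) ×
       SmallestNbrAbove j i (aT b j)))

ExactlyOne4 : Set → Set → Set → Set → Set
ExactlyOne4 P Q R S =
    (P × ¬ Q × ¬ R × ¬ S)
  ⊎ (¬ P × Q × ¬ R × ¬ S)
  ⊎ (¬ P × ¬ Q × R × ¬ S)
  ⊎ (¬ P × ¬ Q × ¬ R × S)

-- Along an edge ij, φ(a) contains α_x β_{ij} γ_y exactly when x is compatible with the position of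
-- a_i relative to j, y with that of a_j relative to i, and, if a_i = j and a_j = i, the pair (x, y) is
-- not the one excluded by the sign a_{ij} (`member`). Hence φ(a) is a maximal clique, and in a
-- rotation φ(a) → φ(b) trading R₁ for R₂ every other route survives, which forces b: according to the
-- kind of clockwise pair (R₁, R₂), b flips a_{ij} (condition 3), lowers a_i to the next neighbour of i
-- (conditions 1 and 4) or raises a_j to the next neighbour of j (conditions 2 and 4). Conversely each
-- such move is a rotation, and a cover: for a weight w increasing along clockwise pairs,
-- Σ_{R ∈ C} w(R) increases along every rotation, and it increases by exactly one along these moves
-- for w(R) = 2i + [R uses α₂] (lowering, flip) or w(R) = 2(m − j) + [R uses γ₁] (raising).

module Submission where

open import Defs
import Algebra.Properties.CommutativeMonoid.Sum as MonoidSum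
open import Algebra.Properties.CommutativeSemigroup using (interchange)
open import Data.Bool using (Bool; true; false; T; _∧_; _∨_; not; if_then_else_)
open import Data.Bool.Properties
  using (T?; T-∧; T-≡; T-irrelevant; ∧-identityʳ; ∧-zeroʳ; ∨-identityʳ; ∨-zeroʳ)
open import Data.Empty using (⊥-elim)
open import Data.Fin using (Fin; toℕ; _≟_; _<?_) renaming (_<_ to _<F_; _≤_ to _≤F_)
open import Data.Fin.Properties
  using (<-cmp; <-asym; ≤-reflexive; ≤-antisym; ≤∧≢⇒<; toℕ<n; punchInᵢ≢i)
  renaming (<-irrefl to <F-irrefl; <-trans to <F-trans)
open import Data.Nat using (ℕ; suc; _+_; _*_; _∸_; _<_; _≤_; z≤n; s≤s)
open import Data.Nat.Properties
  using (+-suc; +-comm; +-identityʳ; +-cancelˡ-≡; +-cancelʳ-≡; +-cancelʳ-<; +-monoʳ-≤; +-monoʳ-<;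
         *-suc; *-monoʳ-≤; m≤m+n; ∸-monoʳ-<; <⇒≤; <⇒≱; ≤-pred; ≤-refl; ≤-trans; <-trans;
         +-0-commutativeMonoid; +-commutativeSemigroup)
open import Data.Product using (Σ; _×_; _,_; proj₁; proj₂)
open import Data.Sum as Sum using (_⊎_; inj₁; inj₂; [_,_]′)
open import Data.Unit using (tt)
open import Data.Vec.Functional using (removeAt; replicate)
open import Function using (case_of_; _∘_)
open import Function.Bundles using (_⇔_; mk⇔; Equivalence)
open import Function.Construct.Composition using (_⇔-∘_)
open import Relation.Binary.Definitions using (tri<; tri≈; tri>)
open import Relation.Binary.PropositionalEquality
open import Relation.Nullary using (¬_; Dec; yes; no; does)
open import Relation.Nullary.Decidable using (dec-true; dec-false; decidable-stable)

open Equivalence using (to; from)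

¬∧ : ∀ {p q} → ¬ T (p ∧ q) → ¬ T p ⊎ ¬ T q
¬∧ {false} _ = inj₁ λ ()
¬∧ {true}  n = inj₂ n

T-ext : ∀ {b b'} → (T b → T b') → (T b' → T b) → b ≡ b'
T-ext {false} {false} _ _ = refl
T-ext {false} {true}  _ g = ⊥-elim (g tt)
T-ext {true}  {false} f _ = ⊥-elim (f tt)
T-ext {true}  {true}  _ _ = refl

¬T⇒≡false : ∀ {b} → ¬ T b → b ≡ false
¬T⇒≡false {false} _ = refl
¬T⇒≡false {true}  n = ⊥-elim (n tt)

_≟Two_ : (x y : Two) → Dec (x ≡ y)
₁ ≟Two ₁ = yes refl
₂ ≟Two ₂ = yes refl
₁ ≟Two ₂ = no λ ()
₂ ≟Two ₁ = no λ ()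

≟₂-≡ : ∀ {x y} → x ≡ y → (x ≟₂ y) ≡ true
≟₂-≡ {₁} refl = refl
≟₂-≡ {₂} refl = refl

≟₂-≢ : ∀ {x y} → x ≢ y → (x ≟₂ y) ≡ false
≟₂-≢ {₁} {₁} x≢y = ⊥-elim (x≢y refl)
≟₂-≢ {₁} {₂} _ = refl
≟₂-≢ {₂} {₁} _ = refl
≟₂-≢ {₂} {₂} x≢y = ⊥-elim (x≢y refl)

_≟S_ : (s t : Sign) → Dec (s ≡ t)
plus  ≟S plus  = yes refl
minus ≟S minus = yes refl
plus  ≟S minus = no λ ()
minus ≟S plus  = no λ ()

every-pair : {P : Two → Two → Set} → P ₁ ₁ → P ₁ ₂ → P ₂ ₁ → P ₂ ₂ → ∀ x y → P x y
every-pair p₁₁ _ _ _ ₁ ₁ = p₁₁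
every-pair _ p₁₂ _ _ ₁ ₂ = p₁₂
every-pair _ _ p₂₁ _ ₂ ₁ = p₂₁
every-pair _ _ _ p₂₂ ₂ ₂ = p₂₂

data Cmp : Set where
  lt eq gt : Cmp

cmp : ∀ {k} → Fin k → Fin k → Cmp
cmp u v with <-cmp u v
... | tri< _ _ _ = lt
... | tri≈ _ _ _ = eq
... | tri> _ _ _ = gt

module _ {k} {u v : Fin k} where

  cmp-< : u <F v → cmp u v ≡ lt
  cmp-< u<v with <-cmp u v
  ... | tri< _ _ _ = refl
  ... | tri≈ _ u≡v _ = ⊥-elim (<F-irrefl u≡v u<v)
  ... | tri> _ _ v<u = ⊥-elim (<-asym u<v v<u)

  cmp-≡ : u ≡ v → cmp u v ≡ eq
  cmp-≡ u≡v with <-cmp u v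
  ... | tri< u<v _ _ = ⊥-elim (<F-irrefl u≡v u<v)
  ... | tri≈ _ _ _ = refl
  ... | tri> _ _ v<u = ⊥-elim (<F-irrefl (sym u≡v) v<u)

  cmp-> : v <F u → cmp u v ≡ gt
  cmp-> v<u with <-cmp u v
  ... | tri< u<v _ _ = ⊥-elim (<-asym u<v v<u)
  ... | tri≈ _ u≡v _ = ⊥-elim (<F-irrefl (sym u≡v) v<u)
  ... | tri> _ _ _ = refl

  cmp-eq⁻¹ : cmp u v ≡ eq → u ≡ v
  cmp-eq⁻¹ c with <-cmp u v
  ... | tri≈ _ u≡v _ = u≡v
  cmp-eq⁻¹ () | tri< _ _ _
  cmp-eq⁻¹ () | tri> _ _ _

-- Which α (resp. γ) a route along ij may use, given where a_i sits relative
-- to j (resp. a_j relative to i): α₂ if a_i < j, α₁ if a_i > j, either on a tie.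
fits : Cmp → Two → Bool
fits lt x = x ≟₂ ₂
fits eq _ = true
fits gt x = x ≟₂ ₁

tie : Sign → Two → Two → Bool
tie minus x y = not ((x ≟₂ ₂) ∧ (y ≟₂ ₁))
tie plus  x y = not ((x ≟₂ ₁) ∧ (y ≟₂ ₂))

member : Cmp → Cmp → Sign → Two → Two → Bool
member eq eq s x y = tie s x y
member c  d  _ x y = fits c x ∧ fits d y

partner : Two → Cmp → Two
partner _ lt = ₂
partner x eq = x
partner _ gt = ₁

fits-partner : ∀ x c → T (fits c (partner x c))
fits-partner _ lt = tt
fits-partner _ eq = tt
fits-partner _ gt = tt

tie-diagonal : ∀ s x → T (tie s x x)
tie-diagonal minus ₁ = tt
tie-diagonal minus ₂ = tt
tie-diagonal plus  ₁ = tt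
tie-diagonal plus  ₂ = tt

member-fits : ∀ {c d s x y} → T (member c d s x y) → T (fits c x) × T (fits d y)
member-fits {eq} {eq} _ = tt , tt
member-fits {lt}      m = to T-∧ m
member-fits {gt}      m = to T-∧ m
member-fits {eq} {lt} m = to T-∧ m
member-fits {eq} {gt} m = to T-∧ m

member-fill-tgt : ∀ c d s x → T (fits c x) → Σ Two λ y → T (member c d s x y)
member-fill-tgt eq eq s x _ = x , tie-diagonal s x
member-fill-tgt eq lt s x f = ₂ , tt
member-fill-tgt eq gt s x f = ₁ , tt
member-fill-tgt lt d  s x f = partner ₁ d , from T-∧ (f , fits-partner ₁ d)
member-fill-tgt gt d  s x f = partner ₁ d , from T-∧ (f , fits-partner ₁ d)

member-fill-src : ∀ c d s y → T (fits d y) → Σ Two λ x → T (member c d s x y)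
member-fill-src eq eq s y _ = y , tie-diagonal s y
member-fill-src lt d  s y f = ₂ , from T-∧ (tt , f)
member-fill-src gt d  s y f = ₁ , from T-∧ (tt , f)
member-fill-src eq lt s y f = ₁ , f
member-fill-src eq gt s y f = ₁ , f

member-not-both : ∀ {c d s} → T (member c d s ₁ ₂) → ¬ T (member c d s ₂ ₁)
member-not-both {lt} ()
member-not-both {gt} _ ()
member-not-both {eq} {lt} _ ()
member-not-both {eq} {gt} ()
member-not-both {eq} {eq} {minus} _ ()
member-not-both {eq} {eq} {plus} ()

¬member : ∀ {c d s x y} → ¬ T (member c d s x y) →
  ¬ T (fits c x) ⊎ ¬ T (fits d y) ⊎ (c ≡ eq × d ≡ eq × ¬ T (tie s x y))
¬member {eq} {eq} n = inj₂ (inj₂ (refl , refl , n))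
¬member {lt}      n = Sum.map₂ inj₁ (¬∧ n)
¬member {gt}      n = Sum.map₂ inj₁ (¬∧ n)
¬member {eq} {lt} n = Sum.map₂ inj₁ (¬∧ n)
¬member {eq} {gt} n = Sum.map₂ inj₁ (¬∧ n)

¬fits-cmp : ∀ {k} {u v : Fin k} {x} → ¬ T (fits (cmp u v) x) →
  (u <F v × x ≡ ₁) ⊎ (v <F u × x ≡ ₂)
¬fits-cmp {u = u} {v} {x} n with <-cmp u v
¬fits-cmp {x = ₁} n | tri< u<v _ _ = inj₁ (u<v , refl)
¬fits-cmp {x = ₂} n | tri< _ _ _ = ⊥-elim (n tt)
¬fits-cmp {x = x} n | tri≈ _ _ _ = ⊥-elim (n tt)
¬fits-cmp {x = ₁} n | tri> _ _ _ = ⊥-elim (n tt)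
¬fits-cmp {x = ₂} n | tri> _ _ v<u = inj₂ (v<u , refl)

¬tie : ∀ {s x y} → ¬ T (tie s x y) →
  (s ≡ minus × x ≡ ₂ × y ≡ ₁) ⊎ (s ≡ plus × x ≡ ₁ × y ≡ ₂)
¬tie {minus} {₂} {₁} _ = inj₁ (refl , refl , refl)
¬tie {plus}  {₁} {₂} _ = inj₂ (refl , refl , refl)
¬tie {minus} {₁}     n = ⊥-elim (n tt)
¬tie {minus} {₂} {₂} n = ⊥-elim (n tt)
¬tie {plus}  {₂}     n = ⊥-elim (n tt)
¬tie {plus}  {₁} {₁} n = ⊥-elim (n tt)

fits₁-cmp : ∀ {k} {u v : Fin k} → T (fits (cmp u v) ₁) → v ≤F u
fits₁-cmp {u = u} {v} f with <-cmp u v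
... | tri≈ _ u≡v _ = ≤-reflexive (sym u≡v)
... | tri> _ _ v<u = <⇒≤ v<u

fits₂-cmp : ∀ {k} {u v : Fin k} → T (fits (cmp u v) ₂) → u ≤F v
fits₂-cmp {u = u} {v} f with <-cmp u v
... | tri< u<v _ _ = <⇒≤ u<v
... | tri≈ _ u≡v _ = ≤-reflexive u≡v

flip-signs : ∀ {c d sa sb} → ¬ T (member c d sa ₂ ₁) → T (member c d sb ₂ ₁) →
  sa ≡ minus × sb ≡ plus
flip-signs {lt}      n m = ⊥-elim (n m)
flip-signs {gt}      n m = ⊥-elim (n m)
flip-signs {eq} {lt} n m = ⊥-elim (n m)
flip-signs {eq} {gt} n m = ⊥-elim (n m)
flip-signs {eq} {eq} {minus} {plus}  _ _ = refl , refl
flip-signs {eq} {eq} {minus} {minus} n m = ⊥-elim (n m)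
flip-signs {eq} {eq} {plus}          n _ = ⊥-elim (n tt)

≟₂-side : ∀ {k} {u v : Fin k} x → u ≢ v →
  (x ≟₂ (if does (u <? v) then ₂ else ₁)) ≡ fits (cmp u v) x
≟₂-side {u = u} {v} x u≢v with <-cmp u v
... | tri< u<v _ _ rewrite dec-true (u <? v) u<v = refl
... | tri≈ _ u≡v _ = ⊥-elim (u≢v u≡v)
... | tri> u≮v _ _ rewrite dec-false (u <? v) u≮v = refl

member-untied : ∀ {c d} s x y → ¬ (c ≡ eq × d ≡ eq) → member c d s x y ≡ fits c x ∧ fits d y
member-untied {lt}      _ _ _ _ = refl
member-untied {gt}      _ _ _ _ = refl
member-untied {eq} {lt} _ _ _ _ = refl
member-untied {eq} {gt} _ _ _ _ = refl
member-untied {eq} {eq} _ _ _ untied = ⊥-elim (untied (refl , refl))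

-- The sign of an edge ij whose endpoint i points at j: + exactly when j points back.
data PlusIffEq : Cmp → Sign → Set where
  lt-minus : PlusIffEq lt minus
  eq-plus  : PlusIffEq eq plus
  gt-minus : PlusIffEq gt minus

plusIffEq : ∀ {c s} → (c ≡ eq → s ≡ plus) → (s ≡ plus → c ≡ eq) → PlusIffEq c s
plusIffEq {lt} {minus} _ _ = lt-minus
plusIffEq {lt} {plus}  _ h = case h refl of λ ()
plusIffEq {eq} {minus} h _ = case h refl of λ ()
plusIffEq {eq} {plus}  _ _ = eq-plus
plusIffEq {gt} {minus} _ _ = gt-minus
plusIffEq {gt} {plus}  _ h = case h refl of λ ()

-- How the moves change one edge: lowering a_i from j to k turns the data (cmp a_i j', cmp a_j' i, a_{ij'})
-- from (eq, t, s) to (lt, t, −) at j' = j and from (gt, t', −) to (eq, t', −) at j' = k; raising a_j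
-- is the mirror image, and a flip changes (eq, eq, −) to (eq, eq, +).
lower-removed∈ : ∀ {t s} → PlusIffEq t s → T (member eq t s ₁ (partner ₁ t))
lower-removed∈ lt-minus = tt
lower-removed∈ eq-plus = tt
lower-removed∈ gt-minus = tt

lower-old-edge : ∀ {t s} → PlusIffEq t s → ∀ x y →
  member lt t minus x y ≡ member eq t s x y ∧ not ((x ≟₂ ₁) ∧ (y ≟₂ partner ₁ t))
lower-old-edge lt-minus = every-pair refl refl refl refl
lower-old-edge eq-plus = every-pair refl refl refl refl
lower-old-edge gt-minus = every-pair refl refl refl refl

lower-new-edge : ∀ t x y →
  member eq t minus x y ≡ member gt t minus x y ∨ ((x ≟₂ ₂) ∧ (y ≟₂ partner ₂ t))
lower-new-edge lt = every-pair refl refl refl refl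
lower-new-edge eq = every-pair refl refl refl refl
lower-new-edge gt = every-pair refl refl refl refl

raise-removed∈ : ∀ {c s} → PlusIffEq c s → T (member c eq s (partner ₂ c) ₂)
raise-removed∈ lt-minus = tt
raise-removed∈ eq-plus = tt
raise-removed∈ gt-minus = tt

raise-added∉ : ∀ c → ¬ T (member c lt minus (partner ₁ c) ₁)
raise-added∉ lt ()
raise-added∉ eq ()
raise-added∉ gt ()

raise-old-edge : ∀ {c s} → PlusIffEq c s → ∀ x y →
  member c gt minus x y ≡ member c eq s x y ∧ not ((x ≟₂ partner ₂ c) ∧ (y ≟₂ ₂))
raise-old-edge lt-minus = every-pair refl refl refl refl
raise-old-edge eq-plus = every-pair refl refl refl refl
raise-old-edge gt-minus = every-pair refl refl refl refl

raise-new-edge : ∀ c x y →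
  member c eq minus x y ≡ member c lt minus x y ∨ ((x ≟₂ partner ₁ c) ∧ (y ≟₂ ₁))
raise-new-edge lt = every-pair refl refl refl refl
raise-new-edge eq = every-pair refl refl refl refl
raise-new-edge gt = every-pair refl refl refl refl

flip-edge : ∀ x y → member eq eq plus x y ≡
  (member eq eq minus x y ∧ not ((x ≟₂ ₁) ∧ (y ≟₂ ₂))) ∨ ((x ≟₂ ₂) ∧ (y ≟₂ ₁))
flip-edge = every-pair refl refl refl refl

record FiniteSum (A : Set) : Set where
  field
    ∑           : (A → ℕ) → ℕ
    ∑-cong      : ∀ {f g} → (∀ a → f a ≡ g a) → ∑ f ≡ ∑ g
    ∑-distrib-+ : ∀ f g → ∑ (λ a → f a + g a) ≡ ∑ f + ∑ g
    ∑-point     : ∀ f p → (∀ a → a ≢ p → f a ≡ 0) → ∑ f ≡ f p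

  ∑-zero : ∑ (λ _ → 0) ≡ 0
  ∑-zero = sym (+-cancelˡ-≡ z 0 z (trans (+-identityʳ z) (∑-distrib-+ (λ _ → 0) (λ _ → 0))))
    where z = ∑ (λ _ → 0)

open FiniteSum

finSum : ∀ k → FiniteSum (Fin k)
finSum k = record
  { ∑ = M.sum ; ∑-cong = M.sum-cong-≗ ; ∑-distrib-+ = M.∑-distrib-+ ; ∑-point = point }
  where
  module M = MonoidSum +-0-commutativeMonoid
  point : ∀ {k} f p → (∀ i → i ≢ p → f i ≡ 0) → M.sum {k} f ≡ f p
  point {suc k} f p h = begin
    M.sum f                      ≡⟨ M.sum-remove f ⟩
    f p + M.sum (removeAt f p)   ≡⟨ cong (f p +_) (M.sum-cong-≗ (λ i → h _ (punchInᵢ≢i p i))) ⟩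
    f p + M.sum (replicate k 0)  ≡⟨ cong (f p +_) (M.sum-replicate-zero k) ⟩
    f p + 0                      ≡⟨ +-identityʳ (f p) ⟩
    f p                          ∎
    where open ≡-Reasoning

twoSum : FiniteSum Two
twoSum = record
  { ∑ = λ f → f ₁ + f ₂
  ; ∑-cong = λ h → cong₂ _+_ (h ₁) (h ₂)
  ; ∑-distrib-+ = λ f g → interchange +-commutativeSemigroup (f ₁) (g ₁) (f ₂) (g ₂)
  ; ∑-point = point }
  where
  point : ∀ f p → (∀ x → x ≢ p → f x ≡ 0) → f ₁ + f ₂ ≡ f p
  point f ₁ h = trans (cong (f ₁ +_) (h ₂ λ ())) (+-identityʳ (f ₁))
  point f ₂ h = cong (_+ f ₂) (h ₁ λ ())

TSum : ∀ b → FiniteSum (T b)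
TSum true  = record { ∑ = λ f → f tt ; ∑-cong = λ h → h tt ; ∑-distrib-+ = λ _ _ → refl
                    ; ∑-point = λ { _ tt _ → refl } }
TSum false = record { ∑ = λ _ → 0 ; ∑-cong = λ _ → refl ; ∑-distrib-+ = λ _ _ → refl
                    ; ∑-point = λ _ () }

ΣSum : ∀ {A : Set} {B : A → Set} → FiniteSum A → (∀ a → FiniteSum (B a)) → FiniteSum (Σ A B)
ΣSum {A} {B} SA SB = record
  { ∑ = λ f → ∑ SA (λ a → ∑ (SB a) (λ b → f (a , b)))
  ; ∑-cong = λ h → ∑-cong SA (λ a → ∑-cong (SB a) (λ b → h (a , b)))
  ; ∑-distrib-+ = λ f g → trans (∑-cong SA (λ a → ∑-distrib-+ (SB a) _ _)) (∑-distrib-+ SA _ _)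
  ; ∑-point = point }
  where
  point : ∀ f p → (∀ ab → ab ≢ p → f ab ≡ 0) →
          ∑ SA (λ a → ∑ (SB a) (λ b → f (a , b))) ≡ f p
  point f (a₀ , b₀) h = trans
    (∑-point SA _ a₀ λ a a≢a₀ →
      trans (∑-cong (SB a) λ b → h (a , b) (λ eq → a≢a₀ (cong proj₁ eq))) (∑-zero (SB a)))
    (∑-point (SB a₀) _ b₀ λ b b≢b₀ → h (a₀ , b) λ { refl → b≢b₀ refl })

transportSum : ∀ {A B : Set} (decode : B → A) (encode : A → B) →
  (∀ b → encode (decode b) ≡ b) → (∀ a → decode (encode a) ≡ a) → FiniteSum B → FiniteSum A
transportSum decode encode ed de SB = record
  { ∑ = λ f → ∑ SB (λ b → f (decode b))
  ; ∑-cong = λ h → ∑-cong SB (λ b → h (decode b))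
  ; ∑-distrib-+ = λ f g → ∑-distrib-+ SB _ _
  ; ∑-point = λ f p h → trans (∑-point SB _ (encode p)
      λ b b≢ → h (decode b) λ eq → b≢ (trans (sym (ed b)) (cong encode eq))) (cong f (de p)) }

bit-< : ∀ {a b} s t → a < b → s ≤ 1 → 2 * a + s < 2 * b + t
bit-< {a} {b} s t a<b s≤1 = begin-strict
  2 * a + s     ≤⟨ +-monoʳ-≤ (2 * a) s≤1 ⟩
  2 * a + 1     <⟨ +-monoʳ-< (2 * a) ≤-refl ⟩
  2 * a + 2     ≡⟨ +-comm (2 * a) 2 ⟩
  2 + 2 * a     ≡⟨ *-suc 2 a ⟨
  2 * suc a     ≤⟨ *-monoʳ-≤ 2 a<b ⟩
  2 * b         ≤⟨ m≤m+n (2 * b) t ⟩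
  2 * b + t     ∎
  where open Data.Nat.Properties.≤-Reasoning

module Routes (H : BipGraph) where
  open BipGraph H
  open Route

  route-≡ : ∀ {x x' i i' j j' y y'} {e : Edge H i j} {e' : Edge H i' j'} →
    x ≡ x' → i ≡ i' → j ≡ j' → y ≡ y' → route x i j y e ≡ route x' i' j' y' e'
  route-≡ {e = e} {e'} refl refl refl refl = cong (route _ _ _ _) (T-irrelevant e e')

  differ-src : ∀ {R R' : Route H} → src R ≢ src R' → R ≢ R'
  differ-src ne same = ne (cong src same)

  differ-rs : ∀ {R R' : Route H} → rs R ≢ rs R' → R ≢ R'
  differ-rs ne same = ne (cong rs same)

  differ-rt : ∀ {R R' : Route H} → rt R ≢ rt R' → R ≢ R'
  differ-rt ne same = ne (cong rt same)

  differ-tgt : ∀ {R R' : Route H} → tgt R ≢ tgt R' → R ≢ R'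
  differ-tgt ne same = ne (cong tgt same)

  -- Abstract, so that later `with`s on _≟_ do not reach inside it.
  abstract
    _≟R_ : (R R' : Route H) → Dec (R ≡ R')
    route x i j y e ≟R route x' i' j' y' e' with x ≟Two x' | i ≟ i' | j ≟ j' | y ≟Two y'
    ... | yes p | yes q | yes r | yes s = yes (route-≡ p q r s)
    ... | no x≢x' | _       | _       | _       = no (differ-src x≢x')
    ... | yes _   | no i≢i' | _       | _       = no (differ-rs i≢i')
    ... | yes _   | yes _   | no j≢j' | _       = no (differ-rt j≢j')
    ... | yes _   | yes _   | yes _   | no y≢y' = no (differ-tgt y≢y')

  ≟R-same-edge : ∀ x x' {i j} y y' (e e' : Edge H i j) →
    does (route x i j y e ≟R route x' i j y' e') ≡ (x ≟₂ x') ∧ (y ≟₂ y')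
  ≟R-same-edge x x' {i} {j} y y' e e' = by-cases (x ≟Two x') (y ≟Two y')
    where
    R = route x i j y e
    R' = route x' i j y' e'
    by-cases : Dec (x ≡ x') → Dec (y ≡ y') → does (R ≟R R') ≡ (x ≟₂ x') ∧ (y ≟₂ y')
    by-cases (yes p) (yes q) =
      trans (dec-true (R ≟R R') (route-≡ p refl refl q)) (sym (cong₂ _∧_ (≟₂-≡ p) (≟₂-≡ q)))
    by-cases (no p)  _       =
      trans (dec-false (R ≟R R') (differ-src p)) (sym (cong (_∧ _) (≟₂-≢ p)))
    by-cases (yes p) (no q)  =
      trans (dec-false (R ≟R R') (differ-tgt q)) (sym (cong₂ _∧_ (≟₂-≡ p) (≟₂-≢ q)))

  routeSum : FiniteSum (Route H)
  routeSum = transportSum decode encode (λ _ → refl) (λ _ → refl)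
    (ΣSum (finSum n) λ i → ΣSum (finSum m) λ j → ΣSum twoSum λ _ → ΣSum twoSum λ _ → TSum (adj i j))
    where
    Code : Set
    Code = Σ (Fin n) λ i → Σ (Fin m) λ j → Σ Two λ _ → Σ Two λ _ → Edge H i j
    decode : Code → Route H
    decode (i , j , x , y , e) = route x i j y e
    encode : Route H → Code
    encode (route x i j y e) = (i , j , x , y , e)

  clockwise-≢ : ∀ {R₁ R₂} → Clockwise H R₁ R₂ → R₁ ≢ R₂
  clockwise-≢ (cw-same _ _ x₁ _ x₂ _) same = case trans (sym x₁) (trans (cong src same) x₂) of λ ()
  clockwise-≢ (cw-S _ j<k _ _) same = <F-irrefl (cong rt (sym same)) j<k
  clockwise-≢ (cw-T _ i<i' _ _) same = <F-irrefl (cong rs same) i<i'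

  rotate : RSet H → Route H → Route H → RSet H
  rotate C R₁ R₂ R = (C R ∧ not (does (R ≟R R₁))) ∨ does (R ≟R R₂)

  ∈rotate : ∀ C R₁ R₂ R → T (rotate C R₁ R₂ R) ⇔ ((T (C R) × R ≢ R₁) ⊎ R ≡ R₂)
  ∈rotate C R₁ R₂ R with R ≟R R₁ | R ≟R R₂
  ... | R≟R₁ | yes R≡R₂ rewrite ∨-zeroʳ (C R ∧ not (does R≟R₁)) =
    mk⇔ (λ _ → inj₂ R≡R₂) (λ _ → tt)
  ... | yes R≡R₁ | no R≢R₂ rewrite ∧-zeroʳ (C R) =
    mk⇔ (λ ()) [ (λ (_ , R≢R₁) → ⊥-elim (R≢R₁ R≡R₁)) , ⊥-elim ∘ R≢R₂ ]′
  ... | no R≢R₁ | no R≢R₂ rewrite ∧-identityʳ (C R) | ∨-identityʳ (C R) =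
    mk⇔ (λ m → inj₁ (m , R≢R₁)) [ proj₁ , ⊥-elim ∘ R≢R₂ ]′

  rotate-away : ∀ C {R₁ R₂ R} → R ≢ R₁ → R ≢ R₂ → rotate C R₁ R₂ R ≡ C R
  rotate-away C {R₁} {R₂} {R} R≢R₁ R≢R₂
    rewrite dec-false (R ≟R R₁) R≢R₁ | dec-false (R ≟R R₂) R≢R₂ | ∧-identityʳ (C R) =
    ∨-identityʳ (C R)

  rotate-removing : ∀ C {R₁ R₂ R} → R ≢ R₂ → rotate C R₁ R₂ R ≡ C R ∧ not (does (R ≟R R₁))
  rotate-removing C {R₁} {R₂} {R} R≢R₂ rewrite dec-false (R ≟R R₂) R≢R₂ = ∨-identityʳ _

  rotate-adding : ∀ C {R₁ R₂ R} → R ≢ R₁ → rotate C R₁ R₂ R ≡ C R ∨ does (R ≟R R₂)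
  rotate-adding C {R₁} {R₂} {R} R≢R₁ rewrite dec-false (R ≟R R₁) R≢R₁ | ∧-identityʳ (C R) = refl

  rotate-cong : ∀ {C C'} R₁ R₂ → _≐_ H C C' → _≐_ H (rotate C R₁ R₂) (rotate C' R₁ R₂)
  rotate-cong R₁ R₂ C≐C' R = cong (λ c → (c ∧ not (does (R ≟R R₁))) ∨ does (R ≟R R₂)) (C≐C' R)

  record Exchange (C C' : RSet H) (R₁ R₂ : Route H) : Set where
    field
      clockwise : Clockwise H R₁ R₂
      R₁∈C      : T (C R₁)
      R₂∉C      : ¬ T (C R₂)
      exchanged : _≐_ H C' (rotate C R₁ R₂)

    R₂∈C' : T (C' R₂)
    R₂∈C' = subst T (sym (exchanged R₂)) (from (∈rotate C R₁ R₂ R₂) (inj₂ refl))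

    C'-membership : ∀ R → T (C' R) ⇔ ((T (C R) × R ≢ R₁) ⊎ R ≡ R₂)
    C'-membership R = mk⇔ (λ m → to (∈rotate C R₁ R₂ R) (subst T (exchanged R) m))
                           (λ m → subst T (sym (exchanged R)) (from (∈rotate C R₁ R₂ R) m))

  open Exchange

  Exchange⇒Rotation : ∀ {C C' R₁ R₂} → IsMaxClique H C → IsMaxClique H C' →
    Exchange C C' R₁ R₂ → Rotation H C C'
  Exchange⇒Rotation {R₁ = R₁} {R₂} max max' ex = max , max' , R₁ , R₂ , clockwise ex , C'-membership ex

  -- A rotation whose removed route is absent from C changes nothing, by maximality of C.
  rotation-cases : ∀ {C C'} → Rotation H C C' →
    (Σ (Route H) λ R₁ → Σ (Route H) λ R₂ → Exchange C C' R₁ R₂) ⊎ _≐_ H C C'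
  rotation-cases {C} {C'} (max , max' , R₁ , R₂ , cw , memb) with T? (C R₁) | T? (C R₂)
  ... | yes R₁∈C | yes R₂∈C = ⊥-elim (proj₁ (proj₁ max R₁ R₂ R₁∈C R₂∈C) cw)
  ... | yes R₁∈C | no R₂∉C  = inj₁ (R₁ , R₂ , record
    { clockwise = cw ; R₁∈C = R₁∈C ; R₂∉C = R₂∉C
    ; exchanged = λ R → T-ext (λ m → from (∈rotate C R₁ R₂ R) (to (memb R) m))
                              (λ m → from (memb R) (to (∈rotate C R₁ R₂ R) m)) })
  ... | no R₁∉C  | _        = inj₂ λ R → T-ext (C⊆C' R) (proj₂ max C' (proj₁ max') C⊆C' R)
    where
    C⊆C' : _⊆R_ H C C'
    C⊆C' R m = from (memb R) (inj₁ (m , λ { refl → R₁∉C m }))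

  Φ : (Route H → ℕ) → RSet H → ℕ
  Φ w C = ∑ routeSum (λ R → if C R then w R else 0)

  Φ-cong : ∀ w {C C'} → _≐_ H C C' → Φ w C ≡ Φ w C'
  Φ-cong w C≐C' = ∑-cong routeSum λ R → cong (λ c → if c then w R else 0) (C≐C' R)

  Φ-rotate : ∀ w {C R₁ R₂} → T (C R₁) → ¬ T (C R₂) → R₁ ≢ R₂ →
    Φ w (rotate C R₁ R₂) + w R₁ ≡ Φ w C + w R₂
  Φ-rotate w {C} {R₁} {R₂} R₁∈C R₂∉C R₁≢R₂ = begin
    Φ w C' + w R₁                       ≡⟨ cong (Φ w C' +_) (∑-at R₁) ⟨
    Φ w C' + ∑ routeSum (at R₁)         ≡⟨ ∑-distrib-+ routeSum (weigh C') (at R₁) ⟨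
    ∑ routeSum (λ R → weigh C' R + at R₁ R) ≡⟨ ∑-cong routeSum pointwise ⟩
    ∑ routeSum (λ R → weigh C R + at R₂ R)  ≡⟨ ∑-distrib-+ routeSum (weigh C) (at R₂) ⟩
    Φ w C + ∑ routeSum (at R₂)          ≡⟨ cong (Φ w C +_) (∑-at R₂) ⟩
    Φ w C + w R₂                        ∎
    where
    open ≡-Reasoning
    C' = rotate C R₁ R₂
    weigh : RSet H → Route H → ℕ
    weigh D R = if D R then w R else 0
    at : Route H → Route H → ℕ
    at R₀ R = if does (R ≟R R₀) then w R else 0
    ∑-at : ∀ R₀ → ∑ routeSum (at R₀) ≡ w R₀
    ∑-at R₀ = trans (∑-point routeSum (at R₀) R₀ λ R → cong (λ b → if b then w R else 0) ∘ dec-false (R ≟R R₀))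
                    (cong (λ b → if b then w R₀ else 0) (dec-true (R₀ ≟R R₀) refl))
    pointwise : ∀ R → weigh C' R + at R₁ R ≡ weigh C R + at R₂ R
    pointwise R with R ≟R R₁ | R ≟R R₂
    ... | yes refl | yes R≡R₂ = ⊥-elim (R₁≢R₂ R≡R₂)
    ... | yes refl | no _ rewrite to T-≡ R₁∈C = +-comm 0 (w R)
    ... | no _ | yes refl rewrite ¬T⇒≡false R₂∉C = +-comm (w R) 0
    ... | no _ | no _ rewrite ∧-identityʳ (C R) | ∨-identityʳ (C R) = refl

  ≐-sym : ∀ {C C'} → _≐_ H C C' → _≐_ H C' C
  ≐-sym C≐C' R = sym (C≐C' R)

  ≐-trans : ∀ {C C' C''} → _≐_ H C C' → _≐_ H C' C'' → _≐_ H C C''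
  ≐-trans C≐C' C'≐C'' R = trans (C≐C' R) (C'≐C'' R)

  Exchange-congˡ : ∀ {C C' D R₁ R₂} → _≐_ H C C' → Exchange C' D R₁ R₂ → Exchange C D R₁ R₂
  Exchange-congˡ {R₁ = R₁} {R₂} C≐C' ex = record
    { clockwise = clockwise ex
    ; R₁∈C = subst T (sym (C≐C' R₁)) (R₁∈C ex)
    ; R₂∉C = λ m → R₂∉C ex (subst T (C≐C' R₂) m)
    ; exchanged = ≐-trans (exchanged ex) (rotate-cong R₁ R₂ (≐-sym C≐C')) }

  Exchange-congʳ : ∀ {C D D' R₁ R₂} → _≐_ H D D' → Exchange C D R₁ R₂ → Exchange C D' R₁ R₂
  Exchange-congʳ D≐D' ex = record
    { clockwise = clockwise ex ; R₁∈C = R₁∈C ex ; R₂∉C = R₂∉C ex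
    ; exchanged = ≐-trans (≐-sym D≐D') (exchanged ex) }

  first-exchange : ∀ {C D} → _≤fr_ H C D → _≐_ H C D ⊎
    Σ (RSet H) λ C₁ → Σ (Route H) λ R₁ → Σ (Route H) λ R₂ →
      Rotation H C C₁ × Exchange C C₁ R₁ R₂ × _≤fr_ H C₁ D
  first-exchange (done C≐D) = inj₁ C≐D
  first-exchange (step rot rest) with rotation-cases rot
  ... | inj₁ (R₁ , R₂ , ex) = inj₂ (_ , R₁ , R₂ , rot , ex , rest)
  ... | inj₂ C≐C' with first-exchange rest
  ...   | inj₁ C'≐D = inj₁ (≐-trans C≐C' C'≐D)
  ...   | inj₂ (C₁ , R₁ , R₂ , rot' , ex , rest') =
    inj₂ (C₁ , R₁ , R₂ , Exchange⇒Rotation (proj₁ rot) (proj₁ (proj₂ rot')) ex' , ex' , rest')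
    where ex' = Exchange-congˡ C≐C' ex

  ⋖⇒Exchange : ∀ {C₁ C₂} → _⋖_ H C₁ C₂ →
    Σ (Route H) λ R₁ → Σ (Route H) λ R₂ → Exchange C₁ C₂ R₁ R₂
  ⋖⇒Exchange (C₁≤C₂ , C₁≭C₂ , between) with first-exchange C₁≤C₂
  ... | inj₁ C₁≐C₂ = ⊥-elim (C₁≭C₂ C₁≐C₂)
  ... | inj₂ (C , R₁ , R₂ , rot , ex , C≤C₂)
        with between C (proj₁ (proj₂ rot)) (step rot (done λ _ → refl)) C≤C₂
  ...   | inj₁ C≐C₁ = ⊥-elim (R₂∉C ex (subst T (C≐C₁ R₂) (R₂∈C' ex)))
  ...   | inj₂ C≐C₂ = R₁ , R₂ , Exchange-congʳ C≐C₂ ex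

  record Potential : Set where
    field
      weight   : Route H → ℕ
      weight-< : ∀ {R₁ R₂} → Clockwise H R₁ R₂ → weight R₁ < weight R₂

  module _ (P : Potential) where
    open Potential P

    Φ-exchange : ∀ {C C' R₁ R₂} → Exchange C C' R₁ R₂ →
      Φ weight C' + weight R₁ ≡ Φ weight C + weight R₂
    Φ-exchange ex = trans (cong (_+ _) (Φ-cong weight (exchanged ex)))
                          (Φ-rotate weight (R₁∈C ex) (R₂∉C ex) (clockwise-≢ (clockwise ex)))

    Φ-exchange-< : ∀ {C C' R₁ R₂} → Exchange C C' R₁ R₂ → Φ weight C < Φ weight C'
    Φ-exchange-< {C} {C'} {R₁} ex = +-cancelʳ-< (weight R₁) (Φ weight C) (Φ weight C')
      (subst (Φ weight C + weight R₁ <_) (sym (Φ-exchange ex))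
             (+-monoʳ-< (Φ weight C) (weight-< (clockwise ex))))

    ≤fr⇒≐⊎Φ< : ∀ {C D} → _≤fr_ H C D → _≐_ H C D ⊎ Φ weight C < Φ weight D
    ≤fr⇒≐⊎Φ< (done C≐D) = inj₁ C≐D
    ≤fr⇒≐⊎Φ< {C} {D} (step rot rest) with rotation-cases rot | ≤fr⇒≐⊎Φ< rest
    ... | inj₁ (_ , _ , ex) | inj₁ C'≐D =
      inj₂ (subst (Φ weight C <_) (Φ-cong weight C'≐D) (Φ-exchange-< ex))
    ... | inj₁ (_ , _ , ex) | inj₂ Φ<    = inj₂ (<-trans (Φ-exchange-< ex) Φ<)
    ... | inj₂ C≐C'         | inj₁ C'≐D = inj₁ (≐-trans C≐C' C'≐D)
    ... | inj₂ C≐C'         | inj₂ Φ<    = inj₂ (subst (_< Φ weight D) (sym (Φ-cong weight C≐C')) Φ<)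

    -- Every rotation raises Φ, and this exchange raises it by one: nothing fits in between.
    unit-exchange⇒⋖ : ∀ {C₁ C₂ R₁ R₂} → IsMaxClique H C₁ → IsMaxClique H C₂ →
      Exchange C₁ C₂ R₁ R₂ → weight R₂ ≡ suc (weight R₁) → _⋖_ H C₁ C₂
    unit-exchange⇒⋖ {C₁} {C₂} {R₁} {R₂} max₁ max₂ ex gap =
      step (Exchange⇒Rotation max₁ max₂ ex) (done λ _ → refl) ,
      (λ C₁≐C₂ → R₂∉C ex (subst T (sym (C₁≐C₂ R₂)) (R₂∈C' ex))) ,
      λ C _ C₁≤C C≤C₂ → between (≤fr⇒≐⊎Φ< C₁≤C) (≤fr⇒≐⊎Φ< C≤C₂)
      where
      Φ₂≡1+Φ₁ : Φ weight C₂ ≡ suc (Φ weight C₁)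
      Φ₂≡1+Φ₁ = +-cancelʳ-≡ (weight R₁) _ _
        (trans (Φ-exchange ex) (trans (cong (Φ weight C₁ +_) gap) (+-suc (Φ weight C₁) (weight R₁))))
      between : ∀ {C} → _≐_ H C₁ C ⊎ Φ weight C₁ < Φ weight C →
                _≐_ H C C₂ ⊎ Φ weight C < Φ weight C₂ → _≐_ H C C₁ ⊎ _≐_ H C C₂
      between (inj₁ C₁≐C) _ = inj₁ (≐-sym C₁≐C)
      between (inj₂ _) (inj₁ C≐C₂) = inj₂ C≐C₂
      between (inj₂ Φ₁<Φ) (inj₂ Φ<Φ₂) =
        ⊥-elim (<⇒≱ Φ₁<Φ (≤-pred (subst (_ <_) Φ₂≡1+Φ₁ Φ<Φ₂)))

module CliqueMap (H : BipGraph) where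
  open BipGraph H
  open Route
  open CliqueVector
  open Routes H

  φ-member : ∀ a x i j y (e : Edge H i j) →
    φ H a (route x i j y e) ≡ member (cmp (aS a i) j) (cmp (aT a j) i) (sg a i j) x y
  φ-member a x i j y e with aS a i ≟ j | aT a j ≟ i
  ... | yes aᵢ≡j | yes aⱼ≡i rewrite cmp-≡ aᵢ≡j | cmp-≡ aⱼ≡i with sg a i j
  ...   | minus = refl
  ...   | plus  = refl
  φ-member a x i j y e | yes aᵢ≡j | no aⱼ≢i rewrite cmp-≡ aᵢ≡j | ≟₂-side y aⱼ≢i =
    sym (member-untied {eq} (sg a i j) x y λ (_ , d≡eq) → aⱼ≢i (cmp-eq⁻¹ d≡eq))
  φ-member a x i j y e | no aᵢ≢j | yes aⱼ≡i rewrite cmp-≡ aⱼ≡i | ≟₂-side x aᵢ≢j =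
    sym (trans (member-untied {d = eq} (sg a i j) x y λ (c≡eq , _) → aᵢ≢j (cmp-eq⁻¹ c≡eq))
               (∧-identityʳ _))
  φ-member a x i j y e | no aᵢ≢j | no aⱼ≢i rewrite ≟₂-side x aᵢ≢j | ≟₂-side y aⱼ≢i =
    sym (member-untied (sg a i j) x y λ (c≡eq , _) → aᵢ≢j (cmp-eq⁻¹ c≡eq))

  φ-at : ∀ a {x i j y} (e : Edge H i j) {c d s} →
    cmp (aS a i) j ≡ c → cmp (aT a j) i ≡ d → sg a i j ≡ s →
    φ H a (route x i j y e) ≡ member c d s x y
  φ-at a e refl refl refl = φ-member a _ _ _ _ e

  module _ (a : CliqueVector H) where

    ∈φ⇒fits : ∀ x i j y e → T (φ H a (route x i j y e)) →
      T (fits (cmp (aS a i) j) x) × T (fits (cmp (aT a j) i) y)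
    ∈φ⇒fits x i j y e m =
      member-fits {cmp (aS a i) j} {cmp (aT a j) i} {sg a i j} (subst T (φ-member a x i j y e) m)

    α₁-bound : ∀ i j y e → T (φ H a (route ₁ i j y e)) → j ≤F aS a i
    α₁-bound i j y e m = fits₁-cmp {u = aS a i} (proj₁ (∈φ⇒fits ₁ i j y e m))

    α₂-bound : ∀ i j y e → T (φ H a (route ₂ i j y e)) → aS a i ≤F j
    α₂-bound i j y e m = fits₂-cmp {u = aS a i} (proj₁ (∈φ⇒fits ₂ i j y e m))

    γ₁-bound : ∀ x i j e → T (φ H a (route x i j ₁ e)) → i ≤F aT a j
    γ₁-bound x i j e m = fits₁-cmp {u = aT a j} (proj₂ (∈φ⇒fits x i j ₁ e m))

    γ₂-bound : ∀ x i j e → T (φ H a (route x i j ₂ e)) → aT a j ≤F i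
    γ₂-bound x i j e m = fits₂-cmp {u = aT a j} (proj₂ (∈φ⇒fits x i j ₂ e m))

    φ-fill-tgt : ∀ {x i j} (e : Edge H i j) → T (fits (cmp (aS a i) j) x) →
      Σ Two λ y → T (φ H a (route x i j y e))
    φ-fill-tgt {x} {i} {j} e f with member-fill-tgt (cmp (aS a i) j) (cmp (aT a j) i) (sg a i j) x f
    ... | y , m = y , subst T (sym (φ-member a x i j y e)) m

    φ-fill-src : ∀ {i j y} (e : Edge H i j) → T (fits (cmp (aT a j) i) y) →
      Σ Two λ x → T (φ H a (route x i j y e))
    φ-fill-src {i} {j} {y} e f with member-fill-src (cmp (aS a i) j) (cmp (aT a j) i) (sg a i j) y f
    ... | x , m = x , subst T (sym (φ-member a x i j y e)) m

    fits-self : ∀ {k} (u : Fin k) x → T (fits (cmp u u) x)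
    fits-self u x = subst (λ c → T (fits c x)) (sym (cmp-≡ {u = u} refl)) tt

    α-at : ∀ i x → Σ Two λ y → T (φ H a (route x i (aS a i) y (aS-nb a i)))
    α-at i x = φ-fill-tgt (aS-nb a i) (fits-self (aS a i) x)

    γ-at : ∀ j y → Σ Two λ x → T (φ H a (route x (aT a j) j y (aT-nb a j)))
    γ-at j y = φ-fill-src (aT-nb a j) (fits-self (aT a j) y)

    φ-no-clockwise : ∀ {R₁ R₂} → T (φ H a R₁) → T (φ H a R₂) → ¬ Clockwise H R₁ R₂
    φ-no-clockwise {route _ i j _ e} {route _ _ _ _ e'} m₁ m₂ (cw-same refl refl refl refl refl refl) =
      member-not-both {cmp (aS a i) j} {cmp (aT a j) i} {sg a i j}
        (subst T (φ-member a ₁ i j ₂ e) m₁) (subst T (φ-member a ₂ i j ₁ e') m₂)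
    φ-no-clockwise {route _ i k y e} {route _ _ j y' e'} m₁ m₂ (cw-S refl j<k refl refl) =
      <⇒≱ j<k (≤-trans (α₁-bound i k y e m₁) (α₂-bound i j y' e' m₂))
    φ-no-clockwise {route x i j _ e} {route x' i' _ _ e'} m₁ m₂ (cw-T refl i<i' refl refl) =
      <⇒≱ i<i' (≤-trans (γ₁-bound x' i' j e' m₂) (γ₂-bound x i j e m₁))

    φ-clique : IsClique H (φ H a)
    φ-clique R₁ R₂ m₁ m₂ = φ-no-clockwise m₁ m₂ , φ-no-clockwise m₂ m₁

    -- A route missing from φ(a) is incoherent with a route of φ(a) that witnesses the violated constraint.
    φ-blocked : ∀ R → ¬ T (φ H a R) →
      Σ (Route H) λ R' → T (φ H a R') × (Clockwise H R R' ⊎ Clockwise H R' R)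
    φ-blocked (route x i j y e) R∉
      with ¬member {cmp (aS a i) j} {cmp (aT a j) i} {sg a i j} {x} {y}
                   (subst (λ b → ¬ T b) (φ-member a x i j y e) R∉)
    ... | inj₁ ¬fitsˢ with ¬fits-cmp {u = aS a i} {j} {x} ¬fitsˢ
    ...   | inj₁ (aᵢ<j , refl) = let (y' , m) = α-at i ₂ in
      route ₂ i (aS a i) y' (aS-nb a i) , m , inj₁ (cw-S refl aᵢ<j refl refl)
    ...   | inj₂ (j<aᵢ , refl) = let (y' , m) = α-at i ₁ in
      route ₁ i (aS a i) y' (aS-nb a i) , m , inj₂ (cw-S refl j<aᵢ refl refl)
    φ-blocked (route x i j y e) R∉ | inj₂ (inj₁ ¬fitsᵗ) with ¬fits-cmp {u = aT a j} {i} {y} ¬fitsᵗ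
    ...   | inj₁ (aⱼ<i , refl) = let (x' , m) = γ-at j ₂ in
      route x' (aT a j) j ₂ (aT-nb a j) , m , inj₂ (cw-T refl aⱼ<i refl refl)
    ...   | inj₂ (i<aⱼ , refl) = let (x' , m) = γ-at j ₁ in
      route x' (aT a j) j ₁ (aT-nb a j) , m , inj₁ (cw-T refl i<aⱼ refl refl)
    φ-blocked (route x i j y e) R∉ | inj₂ (inj₂ (c≡eq , d≡eq , ¬tied))
      with ¬tie {sg a i j} {x} {y} ¬tied
    ...   | inj₁ (s≡minus , refl , refl) = route ₁ i j ₂ e ,
      subst T (sym (φ-at a e c≡eq d≡eq s≡minus)) tt , inj₂ (cw-same refl refl refl refl refl refl)
    ...   | inj₂ (s≡plus , refl , refl) = route ₂ i j ₁ e ,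
      subst T (sym (φ-at a e c≡eq d≡eq s≡plus)) tt , inj₁ (cw-same refl refl refl refl refl refl)

    φ-maximal : IsMaxClique H (φ H a)
    φ-maximal = φ-clique , λ D D-clique φ⊆D R R∈D → decidable-stable (T? (φ H a R)) λ R∉φ →
      let (R' , R'∈φ , cw) = φ-blocked R R∉φ
          (¬cw , ¬cw⁻¹) = D-clique R R' R∈D (φ⊆D R' R'∈φ)
      in [ ¬cw , ¬cw⁻¹ ]′ cw

module Moves (H : BipGraph) where
  open BipGraph H
  open Route
  open CliqueVector
  open Routes H
  open CliqueMap H
  open Potential

  α-bit : Two → ℕ
  α-bit ₁ = 0
  α-bit ₂ = 1

  γ-bit : Two → ℕ
  γ-bit ₁ = 1
  γ-bit ₂ = 0

  α-bit≤1 : ∀ x → α-bit x ≤ 1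
  α-bit≤1 ₁ = z≤n
  α-bit≤1 ₂ = s≤s z≤n

  γ-bit≤1 : ∀ y → γ-bit y ≤ 1
  γ-bit≤1 ₁ = s≤s z≤n
  γ-bit≤1 ₂ = z≤n

  S-potential : Potential
  S-potential .weight R = 2 * toℕ (rs R) + α-bit (src R)
  S-potential .weight-< {R₁} (cw-same refl _ refl _ refl _) = +-monoʳ-< (2 * toℕ (rs R₁)) ≤-refl
  S-potential .weight-< {R₁} (cw-S refl _ refl refl) = +-monoʳ-< (2 * toℕ (rs R₁)) ≤-refl
  S-potential .weight-< {R₁} {R₂} (cw-T _ i<i' _ _) =
    bit-< (α-bit (src R₁)) (α-bit (src R₂)) i<i' (α-bit≤1 (src R₁))

  T-potential : Potential
  T-potential .weight R = 2 * (m ∸ toℕ (rt R)) + γ-bit (tgt R)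
  T-potential .weight-< {R₁} (cw-same _ refl _ refl _ refl) = +-monoʳ-< (2 * (m ∸ toℕ (rt R₁))) ≤-refl
  T-potential .weight-< {R₁} (cw-T refl _ refl refl) = +-monoʳ-< (2 * (m ∸ toℕ (rt R₁))) ≤-refl
  T-potential .weight-< {R₁} {R₂} (cw-S _ j<k _ _) =
    bit-< (γ-bit (tgt R₁)) (γ-bit (tgt R₂)) (∸-monoʳ-< j<k (<⇒≤ (toℕ<n (rt R₁))))
          (γ-bit≤1 (tgt R₁))

  sg-minusˢ : ∀ (a : CliqueVector H) {i j} → aS a i ≢ j → sg a i j ≡ minus
  sg-minusˢ a {i} {j} aᵢ≢j with sg a i j in s
  ... | minus = refl
  ... | plus  = ⊥-elim (aᵢ≢j (proj₁ (sg-ok a i j s)))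

  sg-minusᵗ : ∀ (a : CliqueVector H) {i j} → aT a j ≢ i → sg a i j ≡ minus
  sg-minusᵗ a {i} {j} aⱼ≢i with sg a i j in s
  ... | minus = refl
  ... | plus  = ⊥-elim (aⱼ≢i (proj₂ (sg-ok a i j s)))

  φ-agree : ∀ (a b : CliqueVector H) x i j y (e : Edge H i j) →
    cmp (aS a i) j ≡ cmp (aS b i) j → cmp (aT a j) i ≡ cmp (aT b j) i → sg a i j ≡ sg b i j →
    φ H b (route x i j y e) ≡ φ H a (route x i j y e)
  φ-agree a b x i j y e cˢ cᵗ s = trans (φ-at b e (sym cˢ) (sym cᵗ) (sym s)) (sym (φ-member a x i j y e))

  below-cmp : ∀ {i j k j'} → LargestNbrBelow H i j k → Edge H i j' → j' ≢ j → j' ≢ k →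
    cmp j j' ≡ cmp k j'
  below-cmp {i} {j} {k} {j'} (_ , k<j , largest) e j'≢j j'≢k with <-cmp j' j
  ... | tri< j'<j _ _ = trans (cmp-> j'<j) (sym (cmp-> (≤∧≢⇒< (largest j' e j'<j) j'≢k)))
  ... | tri≈ _ j'≡j _ = ⊥-elim (j'≢j j'≡j)
  ... | tri> _ _ j<j' = trans (cmp-< j<j') (sym (cmp-< (<F-trans k<j j<j')))

  above-cmp : ∀ {j i k i'} → SmallestNbrAbove H j i k → Edge H i' j → i' ≢ i → i' ≢ k →
    cmp i i' ≡ cmp k i'
  above-cmp {j} {i} {k} {i'} (_ , i<k , smallest) e i'≢i i'≢k with <-cmp i' i
  ... | tri< i'<i _ _ = trans (cmp-> i'<i) (sym (cmp-> (<F-trans i'<i i<k)))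
  ... | tri≈ _ i'≡i _ = ⊥-elim (i'≢i i'≡i)
  ... | tri> _ _ i<i' =
    trans (cmp-< i<i') (sym (cmp-< (≤∧≢⇒< (smallest i' e i<i') λ k≡i' → i'≢k (sym k≡i'))))

  record Lower (a b : CliqueVector H) (i : Fin n) (j k : Fin m) : Set where
    field
      a-at-i  : aS a i ≡ j
      b-at-i  : aS b i ≡ k
      k-below : LargestNbrBelow H i j k
      same-S  : ∀ i' → i' ≢ i → aS a i' ≡ aS b i'
      same-T  : ∀ j' → aT a j' ≡ aT b j'
      same-sg : ∀ i' j' → ¬ (i' ≡ i × j' ≡ j) → sg a i' j' ≡ sg b i' j'
      b-sg    : sg b i j ≡ minus
      a-sg    : aT a j ≡ i → sg a i j ≡ plus

  record Raise (a b : CliqueVector H) (i : Fin n) (j : Fin m) (k : Fin n) : Set where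
    field
      a-at-j  : aT a j ≡ i
      b-at-j  : aT b j ≡ k
      k-above : SmallestNbrAbove H j i k
      same-S  : ∀ i' → aS a i' ≡ aS b i'
      same-T  : ∀ j' → j' ≢ j → aT a j' ≡ aT b j'
      same-sg : ∀ i' j' → ¬ (i' ≡ i × j' ≡ j) → sg a i' j' ≡ sg b i' j'
      b-sg    : sg b i j ≡ minus
      a-sg    : aS a i ≡ j → sg a i j ≡ plus

  record Flip (a b : CliqueVector H) (i : Fin n) (j : Fin m) : Set where
    field
      same-S  : ∀ i' → aS a i' ≡ aS b i'
      same-T  : ∀ j' → aT a j' ≡ aT b j'
      same-sg : ∀ i' j' → ¬ (i' ≡ i × j' ≡ j) → sg a i' j' ≡ sg b i' j'
      a-sg    : sg a i j ≡ minus
      b-sg    : sg b i j ≡ plus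

  module LowerExchange {a b i j k} (L : Lower a b i j k) where
    open Lower L

    eij : Edge H i j
    eij = subst (Edge H i) a-at-i (aS-nb a i)

    eik : Edge H i k
    eik = proj₁ k-below

    k<j : k <F j
    k<j = proj₁ (proj₂ k-below)

    t t' : Cmp
    t  = cmp (aT a j) i
    t' = cmp (aT a k) i

    R₁ R₂ : Route H
    R₁ = route ₁ i j (partner ₁ t) eij
    R₂ = route ₂ i k (partner ₂ t') eik

    sign-ij : PlusIffEq t (sg a i j)
    sign-ij = plusIffEq (λ t≡eq → a-sg (cmp-eq⁻¹ t≡eq)) (λ s → cmp-≡ (proj₂ (sg-ok a i j s)))

    k≢j : k ≢ j
    k≢j k≡j = <F-irrefl k≡j k<j

    a-sg-ik : sg a i k ≡ minus
    a-sg-ik = sg-minusˢ a λ aᵢ≡k → k≢j (trans (sym aᵢ≡k) a-at-i)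

    aᵢ-vs-k : cmp (aS a i) k ≡ gt
    aᵢ-vs-k = cmp-> (subst (k <F_) (sym a-at-i) k<j)

    φa-old-edge : ∀ x y (e : Edge H i j) → φ H a (route x i j y e) ≡ member eq t (sg a i j) x y
    φa-old-edge x y e = φ-at a e (cmp-≡ a-at-i) refl refl

    φb-old-edge : ∀ x y (e : Edge H i j) → φ H b (route x i j y e) ≡ member lt t minus x y
    φb-old-edge x y e =
      φ-at b e (cmp-< (subst (_<F j) (sym b-at-i) k<j)) (cong (λ u → cmp u i) (sym (same-T j))) b-sg

    φa-new-edge : ∀ x y (e : Edge H i k) → φ H a (route x i k y e) ≡ member gt t' minus x y
    φa-new-edge x y e = φ-at a e aᵢ-vs-k refl a-sg-ik

    φb-new-edge : ∀ x y (e : Edge H i k) → φ H b (route x i k y e) ≡ member eq t' minus x y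
    φb-new-edge x y e = φ-at b e (cmp-≡ b-at-i) (cong (λ u → cmp u i) (sym (same-T k)))
      (trans (sym (same-sg i k λ (_ , k≡j) → k≢j k≡j)) a-sg-ik)

    exchange : Exchange (φ H a) (φ H b) R₁ R₂
    exchange = record
      { clockwise = cw-S refl k<j refl refl
      ; R₁∈C = subst T (sym (φa-old-edge ₁ (partner ₁ t) eij)) (lower-removed∈ sign-ij)
      ; R₂∉C = λ m → subst T (φa-new-edge ₂ (partner ₂ t') eik) m
      ; exchanged = exchanged }
      where
      open ≡-Reasoning
      exchanged : _≐_ H (φ H b) (rotate (φ H a) R₁ R₂)
      exchanged (route x i' j' y e) with i' ≟ i
      ... | no i'≢i = trans
        (φ-agree a b x i' j' y e (cong (λ u → cmp u j') (same-S i' i'≢i))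
                 (cong (λ u → cmp u i') (same-T j')) (same-sg i' j' λ (i'≡i , _) → i'≢i i'≡i))
        (sym (rotate-away (φ H a) (differ-rs i'≢i) (differ-rs i'≢i)))
      ... | yes refl with j' ≟ j | j' ≟ k
      ...   | yes refl | _ = begin
        φ H b (route x i j y e)                                         ≡⟨ φb-old-edge x y e ⟩
        member lt t minus x y                                           ≡⟨ lower-old-edge sign-ij x y ⟩
        member eq t (sg a i j) x y ∧ not ((x ≟₂ ₁) ∧ (y ≟₂ partner ₁ t))
          ≡⟨ cong₂ (λ p q → p ∧ not q) (φa-old-edge x y e)
                   (≟R-same-edge x ₁ y (partner ₁ t) e eij) ⟨
        φ H a (route x i j y e) ∧ not (does (route x i j y e ≟R R₁))
          ≡⟨ sym (rotate-removing (φ H a) (differ-rt λ j≡k → k≢j (sym j≡k))) ⟩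
        rotate (φ H a) R₁ R₂ (route x i j y e)                          ∎
      ...   | no j≢j' | yes refl = begin
        φ H b (route x i k y e)                                         ≡⟨ φb-new-edge x y e ⟩
        member eq t' minus x y                                          ≡⟨ lower-new-edge t' x y ⟩
        member gt t' minus x y ∨ ((x ≟₂ ₂) ∧ (y ≟₂ partner ₂ t'))
          ≡⟨ cong₂ _∨_ (φa-new-edge x y e) (≟R-same-edge x ₂ y (partner ₂ t') e eik) ⟨
        φ H a (route x i k y e) ∨ does (route x i k y e ≟R R₂)
          ≡⟨ sym (rotate-adding (φ H a) (differ-rt k≢j)) ⟩
        rotate (φ H a) R₁ R₂ (route x i k y e)                          ∎
      ...   | no j'≢j | no j'≢k = trans
        (φ-agree a b x i j' y e
          (trans (cong (λ u → cmp u j') a-at-i)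
                 (trans (below-cmp k-below e j'≢j j'≢k) (cong (λ u → cmp u j') (sym b-at-i))))
          (cong (λ u → cmp u i) (same-T j')) (same-sg i j' λ (_ , j'≡j) → j'≢j j'≡j))
        (sym (rotate-away (φ H a) (differ-rt j'≢j) (differ-rt j'≢k)))

    unit-gap : weight S-potential R₂ ≡ suc (weight S-potential R₁)
    unit-gap = +-suc (2 * toℕ i) 0

  module RaiseExchange {a b i j k} (U : Raise a b i j k) where
    open Raise U

    eij : Edge H i j
    eij = subst (λ u → Edge H u j) a-at-j (aT-nb a j)

    ekj : Edge H k j
    ekj = proj₁ k-above

    i<k : i <F k
    i<k = proj₁ (proj₂ k-above)

    c c' : Cmp
    c  = cmp (aS a i) j
    c' = cmp (aS a k) j

    R₁ R₂ : Route H
    R₁ = route (partner ₂ c) i j ₂ eij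
    R₂ = route (partner ₁ c') k j ₁ ekj

    sign-ij : PlusIffEq c (sg a i j)
    sign-ij = plusIffEq (λ c≡eq → a-sg (cmp-eq⁻¹ c≡eq)) (λ s → cmp-≡ (proj₁ (sg-ok a i j s)))

    i≢k : i ≢ k
    i≢k i≡k = <F-irrefl i≡k i<k

    a-sg-kj : sg a k j ≡ minus
    a-sg-kj = sg-minusᵗ a λ aⱼ≡k → i≢k (trans (sym a-at-j) aⱼ≡k)

    φa-old-edge : ∀ x y (e : Edge H i j) → φ H a (route x i j y e) ≡ member c eq (sg a i j) x y
    φa-old-edge x y e = φ-at a e refl (cmp-≡ a-at-j) refl

    φb-old-edge : ∀ x y (e : Edge H i j) → φ H b (route x i j y e) ≡ member c gt minus x y
    φb-old-edge x y e =
      φ-at b e (cong (λ u → cmp u j) (sym (same-S i))) (cmp-> (subst (i <F_) (sym b-at-j) i<k)) b-sg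

    φa-new-edge : ∀ x y (e : Edge H k j) → φ H a (route x k j y e) ≡ member c' lt minus x y
    φa-new-edge x y e = φ-at a e refl (cmp-< (subst (_<F k) (sym a-at-j) i<k)) a-sg-kj

    φb-new-edge : ∀ x y (e : Edge H k j) → φ H b (route x k j y e) ≡ member c' eq minus x y
    φb-new-edge x y e = φ-at b e (cong (λ u → cmp u j) (sym (same-S k))) (cmp-≡ b-at-j)
      (trans (sym (same-sg k j λ (k≡i , _) → i≢k (sym k≡i))) a-sg-kj)

    exchange : Exchange (φ H a) (φ H b) R₁ R₂
    exchange = record
      { clockwise = cw-T refl i<k refl refl
      ; R₁∈C = subst T (sym (φa-old-edge (partner ₂ c) ₂ eij)) (raise-removed∈ sign-ij)
      ; R₂∉C = λ m → raise-added∉ c' (subst T (φa-new-edge (partner ₁ c') ₁ ekj) m)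
      ; exchanged = exchanged }
      where
      open ≡-Reasoning
      exchanged : _≐_ H (φ H b) (rotate (φ H a) R₁ R₂)
      exchanged (route x i' j' y e) with j' ≟ j
      ... | no j'≢j = trans
        (φ-agree a b x i' j' y e (cong (λ u → cmp u j') (same-S i'))
                 (cong (λ u → cmp u i') (same-T j' j'≢j)) (same-sg i' j' λ (_ , j'≡j) → j'≢j j'≡j))
        (sym (rotate-away (φ H a) (differ-rt j'≢j) (differ-rt j'≢j)))
      ... | yes refl with i' ≟ i | i' ≟ k
      ...   | yes refl | _ = begin
        φ H b (route x i j y e)                                         ≡⟨ φb-old-edge x y e ⟩
        member c gt minus x y                                           ≡⟨ raise-old-edge sign-ij x y ⟩
        member c eq (sg a i j) x y ∧ not ((x ≟₂ partner ₂ c) ∧ (y ≟₂ ₂))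
          ≡⟨ cong₂ (λ p q → p ∧ not q) (φa-old-edge x y e)
                   (≟R-same-edge x (partner ₂ c) y ₂ e eij) ⟨
        φ H a (route x i j y e) ∧ not (does (route x i j y e ≟R R₁))
          ≡⟨ sym (rotate-removing (φ H a) (differ-rs i≢k)) ⟩
        rotate (φ H a) R₁ R₂ (route x i j y e)                          ∎
      ...   | no _ | yes refl = begin
        φ H b (route x k j y e)                                         ≡⟨ φb-new-edge x y e ⟩
        member c' eq minus x y                                          ≡⟨ raise-new-edge c' x y ⟩
        member c' lt minus x y ∨ ((x ≟₂ partner ₁ c') ∧ (y ≟₂ ₁))
          ≡⟨ cong₂ _∨_ (φa-new-edge x y e) (≟R-same-edge x (partner ₁ c') y ₁ e ekj) ⟨
        φ H a (route x k j y e) ∨ does (route x k j y e ≟R R₂)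
          ≡⟨ sym (rotate-adding (φ H a) (differ-rs λ k≡i → i≢k (sym k≡i))) ⟩
        rotate (φ H a) R₁ R₂ (route x k j y e)                          ∎
      ...   | no i'≢i | no i'≢k = trans
        (φ-agree a b x i' j y e (cong (λ u → cmp u j) (same-S i'))
          (trans (cong (λ u → cmp u i') a-at-j)
                 (trans (above-cmp k-above e i'≢i i'≢k) (cong (λ u → cmp u i') (sym b-at-j))))
          (same-sg i' j λ (i'≡i , _) → i'≢i i'≡i))
        (sym (rotate-away (φ H a) (differ-rs i'≢i) (differ-rs i'≢k)))

    unit-gap : weight T-potential R₂ ≡ suc (weight T-potential R₁)
    unit-gap = +-suc (2 * (m ∸ toℕ j)) 0

  module FlipExchange {a b i j} (F : Flip a b i j) where
    open Flip F

    a-at-i : aS a i ≡ j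
    a-at-i = trans (same-S i) (proj₁ (sg-ok b i j b-sg))

    a-at-j : aT a j ≡ i
    a-at-j = trans (same-T j) (proj₂ (sg-ok b i j b-sg))

    eij : Edge H i j
    eij = subst (Edge H i) a-at-i (aS-nb a i)

    R₁ R₂ : Route H
    R₁ = route ₁ i j ₂ eij
    R₂ = route ₂ i j ₁ eij

    φa-edge : ∀ x y (e : Edge H i j) → φ H a (route x i j y e) ≡ member eq eq minus x y
    φa-edge x y e = φ-at a e (cmp-≡ a-at-i) (cmp-≡ a-at-j) a-sg

    φb-edge : ∀ x y (e : Edge H i j) → φ H b (route x i j y e) ≡ member eq eq plus x y
    φb-edge x y e =
      φ-at b e (cmp-≡ (trans (sym (same-S i)) a-at-i)) (cmp-≡ (trans (sym (same-T j)) a-at-j)) b-sg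

    exchange : Exchange (φ H a) (φ H b) R₁ R₂
    exchange = record
      { clockwise = cw-same refl refl refl refl refl refl
      ; R₁∈C = subst T (sym (φa-edge ₁ ₂ eij)) tt
      ; R₂∉C = λ m → subst T (φa-edge ₂ ₁ eij) m
      ; exchanged = exchanged }
      where
      open ≡-Reasoning
      elsewhere : ∀ x i' j' y (e : Edge H i' j') → ¬ (i' ≡ i × j' ≡ j) →
        φ H b (route x i' j' y e) ≡ rotate (φ H a) R₁ R₂ (route x i' j' y e)
      elsewhere x i' j' y e off = trans
        (φ-agree a b x i' j' y e (cong (λ u → cmp u j') (same-S i')) (cong (λ u → cmp u i') (same-T j'))
                 (same-sg i' j' off))
        (sym (rotate-away (φ H a) (λ same → off (cong rs same , cong rt same))
                                  (λ same → off (cong rs same , cong rt same))))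
      exchanged : _≐_ H (φ H b) (rotate (φ H a) R₁ R₂)
      exchanged (route x i' j' y e) with i' ≟ i | j' ≟ j
      ... | no i'≢i | _ = elsewhere x i' j' y e λ (i'≡i , _) → i'≢i i'≡i
      ... | yes _ | no j'≢j = elsewhere x i' j' y e λ (_ , j'≡j) → j'≢j j'≡j
      ... | yes refl | yes refl = begin
        φ H b (route x i j y e)                                         ≡⟨ φb-edge x y e ⟩
        member eq eq plus x y                                           ≡⟨ flip-edge x y ⟩
        (member eq eq minus x y ∧ not ((x ≟₂ ₁) ∧ (y ≟₂ ₂))) ∨ ((x ≟₂ ₂) ∧ (y ≟₂ ₁))
          ≡⟨ cong₂ _∨_ (cong₂ (λ p q → p ∧ not q) (φa-edge x y e) (≟R-same-edge x ₁ y ₂ e eij))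
                       (≟R-same-edge x ₂ y ₁ e eij) ⟨
        rotate (φ H a) R₁ R₂ (route x i j y e)                          ∎

    unit-gap : weight S-potential R₂ ≡ suc (weight S-potential R₁)
    unit-gap = +-suc (2 * toℕ i) 0

  data Move (a b : CliqueVector H) : Set where
    lower : ∀ {i j k} → Lower a b i j k → Move a b
    raise : ∀ {i j k} → Raise a b i j k → Move a b
    flip  : ∀ {i j} → Flip a b i j → Move a b

  Move⇒⋖ : ∀ {a b} → Move a b → _⋖_ H (φ H a) (φ H b)
  Move⇒⋖ {a} {b} (lower L) = unit-exchange⇒⋖ S-potential (φ-maximal a) (φ-maximal b) exchange unit-gap
    where open LowerExchange L
  Move⇒⋖ {a} {b} (raise U) = unit-exchange⇒⋖ T-potential (φ-maximal a) (φ-maximal b) exchange unit-gap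
    where open RaiseExchange U
  Move⇒⋖ {a} {b} (flip F) = unit-exchange⇒⋖ S-potential (φ-maximal a) (φ-maximal b) exchange unit-gap
    where open FlipExchange F

  -- φ(a) has routes α₁β_{i aᵢ} and α₂β_{i aᵢ}; kept in φ(b), they bound b_i from both sides.
  aS-from-edge : ∀ a b i →
    (∀ x y → φ H b (route x i (aS a i) y (aS-nb a i)) ≡ φ H a (route x i (aS a i) y (aS-nb a i))) →
    aS a i ≡ aS b i
  aS-from-edge a b i same =
    let (y₁ , m₁) = α-at a i ₁ ; (y₂ , m₂) = α-at a i ₂ in
    ≤-antisym (α₁-bound b i (aS a i) y₁ (aS-nb a i) (subst T (sym (same ₁ y₁)) m₁))
              (α₂-bound b i (aS a i) y₂ (aS-nb a i) (subst T (sym (same ₂ y₂)) m₂))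

  aT-from-edge : ∀ a b j →
    (∀ x y → φ H b (route x (aT a j) j y (aT-nb a j)) ≡ φ H a (route x (aT a j) j y (aT-nb a j))) →
    aT a j ≡ aT b j
  aT-from-edge a b j same =
    let (x₁ , m₁) = γ-at a j ₁ ; (x₂ , m₂) = γ-at a j ₂ in
    ≤-antisym (γ₁-bound b x₁ (aT a j) j (aT-nb a j) (subst T (sym (same x₁ ₁)) m₁))
              (γ₂-bound b x₂ (aT a j) j (aT-nb a j) (subst T (sym (same x₂ ₂)) m₂))

  -- One of a_i, b_i differs from j₀, and aS-from-edge applies to it.
  aS-determined : ∀ a b i j₀ →
    (∀ x j' y e → j' ≢ j₀ → φ H b (route x i j' y e) ≡ φ H a (route x i j' y e)) → aS a i ≡ aS b i
  aS-determined a b i j₀ same with aS a i ≟ j₀ | aS b i ≟ j₀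
  ... | no aᵢ≢j₀ | _ = aS-from-edge a b i λ x y → same x (aS a i) y (aS-nb a i) aᵢ≢j₀
  ... | yes aᵢ≡j₀ | yes bᵢ≡j₀ = trans aᵢ≡j₀ (sym bᵢ≡j₀)
  ... | yes _ | no bᵢ≢j₀ = sym (aS-from-edge b a i λ x y → sym (same x (aS b i) y (aS-nb b i) bᵢ≢j₀))

  aT-determined : ∀ a b j i₀ →
    (∀ x i' y e → i' ≢ i₀ → φ H b (route x i' j y e) ≡ φ H a (route x i' j y e)) → aT a j ≡ aT b j
  aT-determined a b j i₀ same with aT a j ≟ i₀ | aT b j ≟ i₀
  ... | no aⱼ≢i₀ | _ = aT-from-edge a b j λ x y → same x (aT a j) y (aT-nb a j) aⱼ≢i₀
  ... | yes aⱼ≡i₀ | yes bⱼ≡i₀ = trans aⱼ≡i₀ (sym bⱼ≡i₀)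
  ... | yes _ | no bⱼ≢i₀ = sym (aT-from-edge b a j λ x y → sym (same x (aT b j) y (aT-nb b j) bⱼ≢i₀))

  separating-route : ∀ a b {i j} → sg a i j ≡ plus → sg b i j ≡ minus →
    aS a i ≡ aS b i → aT a j ≡ aT b j →
    Σ (Edge H i j) λ e → T (φ H a (route ₂ i j ₁ e)) × ¬ T (φ H b (route ₂ i j ₁ e))
  separating-route a b {i} {j} sa sb aᵢ≡bᵢ aⱼ≡bⱼ =
    e , subst T (sym (φ-at a e (cmp-≡ aᵢ≡j) (cmp-≡ aⱼ≡i) sa)) tt ,
    subst T (φ-at b e (cmp-≡ (trans (sym aᵢ≡bᵢ) aᵢ≡j)) (cmp-≡ (trans (sym aⱼ≡bⱼ) aⱼ≡i)) sb)
    where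
    aᵢ≡j = proj₁ (sg-ok a i j sa)
    aⱼ≡i = proj₂ (sg-ok a i j sa)
    e = subst (Edge H i) aᵢ≡j (aS-nb a i)

  sg-from-edge : ∀ a b i j → (∀ x y e → φ H b (route x i j y e) ≡ φ H a (route x i j y e)) →
    aS a i ≡ aS b i → aT a j ≡ aT b j → sg a i j ≡ sg b i j
  sg-from-edge a b i j same aᵢ≡bᵢ aⱼ≡bⱼ with sg a i j in sa | sg b i j in sb
  ... | minus | minus = refl
  ... | plus  | plus  = refl
  ... | plus  | minus = let (e , ∈a , ∉b) = separating-route a b sa sb aᵢ≡bᵢ aⱼ≡bⱼ in
    ⊥-elim (∉b (subst T (sym (same ₂ ₁ e)) ∈a))
  ... | minus | plus  = let (e , ∈b , ∉a) = separating-route b a sb sa (sym aᵢ≡bᵢ) (sym aⱼ≡bⱼ) in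
    ⊥-elim (∉a (subst T (same ₂ ₁ e) ∈b))

  module ExchangeAnalysis (a b : CliqueVector H) {R₁ R₂} (ex : Exchange (φ H a) (φ H b) R₁ R₂) where

    unchanged : ∀ R → R ≢ R₁ → R ≢ R₂ → φ H b R ≡ φ H a R
    unchanged R R≢R₁ R≢R₂ = trans (Exchange.exchanged ex R) (rotate-away (φ H a) R≢R₁ R≢R₂)

    kept : ∀ R → R ≢ R₁ → R ≢ R₂ → T (φ H a R) → T (φ H b R)
    kept R R≢R₁ R≢R₂ = subst T (sym (unchanged R R≢R₁ R≢R₂))

    kept⁻¹ : ∀ R → R ≢ R₁ → R ≢ R₂ → T (φ H b R) → T (φ H a R)
    kept⁻¹ R R≢R₁ R≢R₂ = subst T (unchanged R R≢R₁ R≢R₂)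

    row-unchanged : ∀ i' → i' ≢ rs R₁ → i' ≢ rs R₂ →
      ∀ x j' y e → φ H b (route x i' j' y e) ≡ φ H a (route x i' j' y e)
    row-unchanged i' ne₁ ne₂ x j' y e = unchanged (route x i' j' y e) (differ-rs ne₁) (differ-rs ne₂)

    column-unchanged : ∀ j' → j' ≢ rt R₁ → j' ≢ rt R₂ →
      ∀ x i' y e → φ H b (route x i' j' y e) ≡ φ H a (route x i' j' y e)
    column-unchanged j' ne₁ ne₂ x i' y e = unchanged (route x i' j' y e) (differ-rt ne₁) (differ-rt ne₂)

  module LowerAnalysis (a b : CliqueVector H) {i j k y₁ y₂} {e₁ : Edge H i j} {e₂ : Edge H i k}
           (k<j : k <F j) (ex : Exchange (φ H a) (φ H b) (route ₁ i j y₁ e₁) (route ₂ i k y₂ e₂))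
           where
    open ExchangeAnalysis a b ex

    k≢j : k ≢ j
    k≢j k≡j = <F-irrefl k≡j k<j

    same-S : ∀ i' → i' ≢ i → aS a i' ≡ aS b i'
    same-S i' i'≢i = aS-determined a b i' j λ x j' y e _ → row-unchanged i' i'≢i i'≢i x j' y e

    same-T : ∀ j' → aT a j' ≡ aT b j'
    same-T j' = aT-determined a b j' i λ x i' y e i'≢i → row-unchanged i' i'≢i i'≢i x j' y e

    squeeze : ¬ (aS a i ≤F aS b i)
    squeeze aᵢ≤bᵢ = <⇒≱ k<j (≤-trans (α₁-bound a i j y₁ e₁ (Exchange.R₁∈C ex))
                              (≤-trans aᵢ≤bᵢ (α₂-bound b i k y₂ e₂ (Exchange.R₂∈C' ex))))

    a-at-i : aS a i ≡ j
    a-at-i with aS a i ≟ j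
    ... | yes aᵢ≡j = aᵢ≡j
    ... | no aᵢ≢j = let (y , m) = α-at a i ₁ in ⊥-elim (squeeze (α₁-bound b i (aS a i) y (aS-nb a i)
          (kept (route ₁ i (aS a i) y (aS-nb a i)) (differ-rt aᵢ≢j) (differ-src λ ()) m)))

    b-at-i : aS b i ≡ k
    b-at-i with aS b i ≟ k
    ... | yes bᵢ≡k = bᵢ≡k
    ... | no bᵢ≢k = let (y , m) = α-at b i ₂ in ⊥-elim (squeeze (α₂-bound a i (aS b i) y (aS-nb b i)
          (kept⁻¹ (route ₂ i (aS b i) y (aS-nb b i)) (differ-src λ ()) (differ-rt bᵢ≢k) m)))

    k-below : LargestNbrBelow H i j k
    k-below = e₂ , k<j , λ l e l<j →
      let aᵢ-vs-l = cmp-> (subst (l <F_) (sym a-at-i) l<j)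
          (y , m) = φ-fill-tgt a e (subst (λ c → T (fits c ₁)) (sym aᵢ-vs-l) tt) in
      subst (l ≤F_) b-at-i (α₁-bound b i l y e
        (kept (route ₁ i l y e) (differ-rt λ l≡j → <F-irrefl l≡j l<j) (differ-src λ ()) m))

    a-sg-ik : sg a i k ≡ minus
    a-sg-ik = sg-minusˢ a λ aᵢ≡k → k≢j (trans (sym aᵢ≡k) a-at-i)

    -- otherwise φ(b) would lose α₁β_{ik}γ₂, which R₁ ↦ R₂ does not touch
    new-edge-sg : sg a i k ≡ sg b i k
    new-edge-sg with sg b i k in sb
    ... | minus = a-sg-ik
    ... | plus  = ⊥-elim (∉b (kept R (differ-rt k≢j) (differ-src λ ()) ∈a))
      where
      R = route ₁ i k ₂ e₂
      aₖ≡i = trans (same-T k) (proj₂ (sg-ok b i k sb))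
      ∈a : T (φ H a R)
      ∈a = subst T (sym (φ-at a e₂ (cmp-> (subst (k <F_) (sym a-at-i) k<j)) (cmp-≡ aₖ≡i) a-sg-ik)) tt
      ∉b : ¬ T (φ H b R)
      ∉b = subst T (φ-at b e₂ (cmp-≡ b-at-i) (cmp-≡ (proj₂ (sg-ok b i k sb))) sb)

    same-sg : ∀ i' j' → ¬ (i' ≡ i × j' ≡ j) → sg a i' j' ≡ sg b i' j'
    same-sg i' j' off with i' ≟ i
    ... | no i'≢i =
      sg-from-edge a b i' j' (λ x y e → row-unchanged i' i'≢i i'≢i x j' y e) (same-S i' i'≢i) (same-T j')
    ... | yes refl with j' ≟ k
    ...   | yes refl = new-edge-sg
    ...   | no j'≢k = trans (sg-minusˢ a λ aᵢ≡j' → off (refl , trans (sym aᵢ≡j') a-at-i))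
                            (sym (sg-minusˢ b λ bᵢ≡j' → j'≢k (trans (sym bᵢ≡j') b-at-i)))

    -- otherwise φ(a) would lack α₂β_{ij}γ₁, which R₁ ↦ R₂ does not touch
    a-sg : aT a j ≡ i → sg a i j ≡ plus
    a-sg aⱼ≡i with sg a i j in sa
    ... | plus  = refl
    ... | minus = ⊥-elim (∉a (kept⁻¹ R (differ-src λ ()) (differ-rt λ j≡k → k≢j (sym j≡k)) ∈b))
      where
      R = route ₂ i j ₁ e₁
      ∈b : T (φ H b R)
      ∈b = subst T (sym (φ-at b e₁ (cmp-< (subst (_<F j) (sym b-at-i) k<j))
                                    (cmp-≡ (trans (sym (same-T j)) aⱼ≡i)) refl)) tt
      ∉a : ¬ T (φ H a R)
      ∉a = subst T (φ-at a e₁ (cmp-≡ a-at-i) (cmp-≡ aⱼ≡i) sa)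

    lowering : Lower a b i j k
    lowering = record
      { a-at-i = a-at-i ; b-at-i = b-at-i ; k-below = k-below ; same-S = same-S ; same-T = same-T
      ; same-sg = same-sg ; b-sg = sg-minusˢ b λ bᵢ≡j → k≢j (trans (sym b-at-i) bᵢ≡j) ; a-sg = a-sg }

  module RaiseAnalysis (a b : CliqueVector H) {i j k x₁ x₂} {e₁ : Edge H i j} {e₂ : Edge H k j}
           (i<k : i <F k) (ex : Exchange (φ H a) (φ H b) (route x₁ i j ₂ e₁) (route x₂ k j ₁ e₂))
           where
    open ExchangeAnalysis a b ex

    i≢k : i ≢ k
    i≢k i≡k = <F-irrefl i≡k i<k

    same-S : ∀ i' → aS a i' ≡ aS b i'
    same-S i' = aS-determined a b i' j λ x j' y e j'≢j → column-unchanged j' j'≢j j'≢j x i' y e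

    same-T : ∀ j' → j' ≢ j → aT a j' ≡ aT b j'
    same-T j' j'≢j = aT-determined a b j' i λ x i' y e _ → column-unchanged j' j'≢j j'≢j x i' y e

    squeeze : ¬ (aT b j ≤F aT a j)
    squeeze bⱼ≤aⱼ = <⇒≱ i<k (≤-trans (γ₁-bound b x₂ k j e₂ (Exchange.R₂∈C' ex))
                              (≤-trans bⱼ≤aⱼ (γ₂-bound a x₁ i j e₁ (Exchange.R₁∈C ex))))

    a-at-j : aT a j ≡ i
    a-at-j with aT a j ≟ i
    ... | yes aⱼ≡i = aⱼ≡i
    ... | no aⱼ≢i = let (x , m) = γ-at a j ₂ in ⊥-elim (squeeze (γ₂-bound b x (aT a j) j (aT-nb a j)
          (kept (route x (aT a j) j ₂ (aT-nb a j)) (differ-rs aⱼ≢i) (differ-tgt λ ()) m)))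

    b-at-j : aT b j ≡ k
    b-at-j with aT b j ≟ k
    ... | yes bⱼ≡k = bⱼ≡k
    ... | no bⱼ≢k = let (x , m) = γ-at b j ₁ in ⊥-elim (squeeze (γ₁-bound a x (aT b j) j (aT-nb b j)
          (kept⁻¹ (route x (aT b j) j ₁ (aT-nb b j)) (differ-tgt λ ()) (differ-rs bⱼ≢k) m)))

    k-above : SmallestNbrAbove H j i k
    k-above = e₂ , i<k , λ l e i<l →
      let aⱼ-vs-l = cmp-< (subst (_<F l) (sym a-at-j) i<l)
          (x , m) = φ-fill-src a e (subst (λ c → T (fits c ₂)) (sym aⱼ-vs-l) tt) in
      subst (_≤F l) b-at-j (γ₂-bound b x l j e
        (kept (route x l j ₂ e) (differ-rs λ l≡i → <F-irrefl (sym l≡i) i<l) (differ-tgt λ ()) m))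

    a-sg-kj : sg a k j ≡ minus
    a-sg-kj = sg-minusᵗ a λ aⱼ≡k → i≢k (trans (sym a-at-j) aⱼ≡k)

    -- otherwise φ(b) would lose α₁β_{kj}γ₂, which R₁ ↦ R₂ does not touch
    new-edge-sg : sg a k j ≡ sg b k j
    new-edge-sg with sg b k j in sb
    ... | minus = a-sg-kj
    ... | plus  = ⊥-elim (∉b (kept R (differ-rs λ k≡i → i≢k (sym k≡i)) (differ-tgt λ ()) ∈a))
      where
      R = route ₁ k j ₂ e₂
      aₖ≡j = trans (same-S k) (proj₁ (sg-ok b k j sb))
      ∈a : T (φ H a R)
      ∈a = subst T (sym (φ-at a e₂ (cmp-≡ aₖ≡j) (cmp-< (subst (_<F k) (sym a-at-j) i<k)) a-sg-kj)) tt
      ∉b : ¬ T (φ H b R)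
      ∉b = subst T (φ-at b e₂ (cmp-≡ (proj₁ (sg-ok b k j sb))) (cmp-≡ b-at-j) sb)

    same-sg : ∀ i' j' → ¬ (i' ≡ i × j' ≡ j) → sg a i' j' ≡ sg b i' j'
    same-sg i' j' off with j' ≟ j
    ... | no j'≢j =
      sg-from-edge a b i' j' (λ x y e → column-unchanged j' j'≢j j'≢j x i' y e) (same-S i') (same-T j' j'≢j)
    ... | yes refl with i' ≟ k
    ...   | yes refl = new-edge-sg
    ...   | no i'≢k = trans (sg-minusᵗ a λ aⱼ≡i' → off (trans (sym aⱼ≡i') a-at-j , refl))
                            (sym (sg-minusᵗ b λ bⱼ≡i' → i'≢k (trans (sym bⱼ≡i') b-at-j)))

    -- otherwise φ(a) would lack α₂β_{ij}γ₁, which R₁ ↦ R₂ does not touch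
    a-sg : aS a i ≡ j → sg a i j ≡ plus
    a-sg aᵢ≡j with sg a i j in sa
    ... | plus  = refl
    ... | minus = ⊥-elim (∉a (kept⁻¹ R (differ-tgt λ ()) (differ-rs i≢k) ∈b))
      where
      R = route ₂ i j ₁ e₁
      ∈b : T (φ H b R)
      ∈b = subst T (sym (φ-at b e₁ (cmp-≡ (trans (sym (same-S i)) aᵢ≡j))
                                    (cmp-> (subst (i <F_) (sym b-at-j) i<k)) refl)) tt
      ∉a : ¬ T (φ H a R)
      ∉a = subst T (φ-at a e₁ (cmp-≡ aᵢ≡j) (cmp-≡ a-at-j) sa)

    raising : Raise a b i j k
    raising = record
      { a-at-j = a-at-j ; b-at-j = b-at-j ; k-above = k-above ; same-S = same-S ; same-T = same-T
      ; same-sg = same-sg ; b-sg = sg-minusᵗ b λ bⱼ≡i → i≢k (trans (sym bⱼ≡i) b-at-j) ; a-sg = a-sg }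

  exchange⇒Flip : ∀ a b {i j} (e e' : Edge H i j) →
    Exchange (φ H a) (φ H b) (route ₁ i j ₂ e) (route ₂ i j ₁ e') → Flip a b i j
  exchange⇒Flip a b {i} {j} e e' ex = record
    { same-S = same-S ; same-T = same-T ; same-sg = same-sg
    ; a-sg = proj₁ signs ; b-sg = proj₂ signs }
    where
    open ExchangeAnalysis a b ex
    same-S : ∀ i' → aS a i' ≡ aS b i'
    same-S i' = aS-determined a b i' j λ x j' y e j'≢j → column-unchanged j' j'≢j j'≢j x i' y e
    same-T : ∀ j' → aT a j' ≡ aT b j'
    same-T j' = aT-determined a b j' i λ x i' y e i'≢i → row-unchanged i' i'≢i i'≢i x j' y e
    same-sg : ∀ i' j' → ¬ (i' ≡ i × j' ≡ j) → sg a i' j' ≡ sg b i' j'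
    same-sg i' j' off = sg-from-edge a b i' j'
      (λ x y e → unchanged (route x i' j' y e) (λ same → off (cong rs same , cong rt same))
                                               (λ same → off (cong rs same , cong rt same)))
      (same-S i') (same-T j')
    signs : sg a i j ≡ minus × sg b i j ≡ plus
    signs = flip-signs {cmp (aS a i) j} {cmp (aT a j) i}
      (λ m → Exchange.R₂∉C ex (subst T (sym (φ-member a ₂ i j ₁ e')) m))
      (subst T (φ-at b e' (cong (λ u → cmp u j) (sym (same-S i))) (cong (λ u → cmp u i) (sym (same-T j)))
                          refl)
             (Exchange.R₂∈C' ex))

  exchange⇒Move : ∀ a b {R₁ R₂} → Exchange (φ H a) (φ H b) R₁ R₂ → Move a b
  exchange⇒Move a b ex = by-kind (Exchange.clockwise ex) ex
    where
    by-kind : ∀ {R₁ R₂} → Clockwise H R₁ R₂ → Exchange (φ H a) (φ H b) R₁ R₂ → Move a b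
    by-kind {route _ _ _ _ e} {route _ _ _ _ e'} (cw-same refl refl refl refl refl refl) ex =
      flip (exchange⇒Flip a b e e' ex)
    by-kind (cw-S refl k<j refl refl) ex = lower (LowerAnalysis.lowering a b k<j ex)
    by-kind (cw-T refl i<k refl refl) ex = raise (RaiseAnalysis.raising a b i<k ex)

  ⋖⇔Move : ∀ a b → _⋖_ H (φ H a) (φ H b) ⇔ Move a b
  ⋖⇔Move a b = mk⇔ (λ cover → let (_ , _ , ex) = ⋖⇒Exchange cover in exchange⇒Move a b ex) Move⇒⋖

module Conditions (H : BipGraph) where
  open BipGraph H
  open CliqueVector
  open Moves H

  AgreeAt : CliqueVector H → CliqueVector H → Entry H → Set
  AgreeAt a b (eS i)   = aS a i ≡ aS b i
  AgreeAt a b (eT j)   = aT a j ≡ aT b j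
  AgreeAt a b (eE i j) = sg a i j ≡ sg b i j

  agree? : ∀ a b e → Dec (AgreeAt a b e)
  agree? a b (eS i)   = aS a i ≟ aS b i
  agree? a b (eT j)   = aT a j ≟ aT b j
  agree? a b (eE i j) = sg a i j ≟S sg b i j

  _≟ₑ_ : (e e' : Entry H) → Dec (e ≡ e')
  eS i   ≟ₑ eS i'    with i ≟ i'
  ... | yes refl = yes refl
  ... | no i≢i'  = no λ { refl → i≢i' refl }
  eT j   ≟ₑ eT j'    with j ≟ j'
  ... | yes refl = yes refl
  ... | no j≢j'  = no λ { refl → j≢j' refl }
  eE i j ≟ₑ eE i' j' with i ≟ i' | j ≟ j'
  ... | yes refl | yes refl = yes refl
  ... | no i≢i'  | _        = no λ { refl → i≢i' refl }
  ... | yes _    | no j≢j'  = no λ { refl → j≢j' refl }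
  eS _ ≟ₑ eT _   = no λ ()
  eS _ ≟ₑ eE _ _ = no λ ()
  eT _ ≟ₑ eS _   = no λ ()
  eT _ ≟ₑ eE _ _ = no λ ()
  eE _ _ ≟ₑ eS _ = no λ ()
  eE _ _ ≟ₑ eT _ = no λ ()

  AnyCond : CliqueVector H → CliqueVector H → Set
  AnyCond a b = Cond1 H a b ⊎ Cond2 H a b ⊎ Cond3 H a b ⊎ Cond4 H a b

  either? : ∀ e₁ e₂ e → Dec (e ≡ e₁ ⊎ e ≡ e₂)
  either? e₁ e₂ e with e ≟ₑ e₁ | e ≟ₑ e₂
  ... | yes p | _     = yes (inj₁ p)
  ... | no _  | yes q = yes (inj₂ q)
  ... | no p  | no q  = no [ p , q ]′

  module _ {a b : CliqueVector H} where

    ¬agree⇒differs : ∀ e → ¬ AgreeAt a b e → DiffersAt H a b e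
    ¬agree⇒differs (eS _)   d = d
    ¬agree⇒differs (eT _)   d = d
    ¬agree⇒differs (eE _ _) d = d

    differs⇒¬agree : ∀ e → DiffersAt H a b e → ¬ AgreeAt a b e
    differs⇒¬agree (eS _)   d = d
    differs⇒¬agree (eT _)   d = d
    differs⇒¬agree (eE _ _) d = d

    agree-off : ∀ {P} → DifferExactlyAt H a b P → ∀ e → ¬ P e → AgreeAt a b e
    agree-off D e ¬Pe with agree? a b e
    ... | yes agree = agree
    ... | no differ = ⊥-elim (¬Pe (to (D e) (¬agree⇒differs e differ)))

    differExactlyAt : ∀ {P} → (∀ e → Dec (P e)) → (∀ e → ¬ P e → AgreeAt a b e) →
      (∀ e → P e → DiffersAt H a b e) → DifferExactlyAt H a b P
    differExactlyAt P? agree differ e = mk⇔ onP (differ e)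
      where
      onP : DiffersAt H a b e → _
      onP d with P? e
      ... | yes Pe = Pe
      ... | no ¬Pe = ⊥-elim (differs⇒¬agree e d (agree e ¬Pe))

    lower-agree : ∀ {i j k} → Lower a b i j k → ∀ e → e ≢ eS i → e ≢ eE i j → AgreeAt a b e
    lower-agree L (eS i') ≢eS _   = Lower.same-S L i' λ { refl → ≢eS refl }
    lower-agree L (eT j') _ _     = Lower.same-T L j'
    lower-agree L (eE i' j') _ ≢eE = Lower.same-sg L i' j' λ { (refl , refl) → ≢eE refl }

    raise-agree : ∀ {i j k} → Raise a b i j k → ∀ e → e ≢ eT j → e ≢ eE i j → AgreeAt a b e
    raise-agree U (eS i') _ _     = Raise.same-S U i'
    raise-agree U (eT j') ≢eT _   = Raise.same-T U j' λ { refl → ≢eT refl }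
    raise-agree U (eE i' j') _ ≢eE = Raise.same-sg U i' j' λ { (refl , refl) → ≢eE refl }

    flip-agree : ∀ {i j} → Flip a b i j → ∀ e → e ≢ eE i j → AgreeAt a b e
    flip-agree F (eS i') _      = Flip.same-S F i'
    flip-agree F (eT j') _      = Flip.same-T F j'
    flip-agree F (eE i' j') ≢eE = Flip.same-sg F i' j' λ { (refl , refl) → ≢eE refl }

    lower-moves : ∀ {i j k} → Lower a b i j k → DiffersAt H a b (eS i)
    lower-moves L same = <F-irrefl (trans (sym b-at-i) (trans (sym same) a-at-i)) (proj₁ (proj₂ k-below))
      where open Lower L

    raise-moves : ∀ {i j k} → Raise a b i j k → DiffersAt H a b (eT j)
    raise-moves U same = <F-irrefl (trans (sym a-at-j) (trans same b-at-j)) (proj₁ (proj₂ k-above))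
      where open Raise U

    signs-differ : ∀ {i j s t} → s ≢ t → sg a i j ≡ s → sg b i j ≡ t → DiffersAt H a b (eE i j)
    signs-differ s≢t sa sb same = s≢t (trans (sym sa) (trans same sb))

    Lower⇒Cond : ∀ {i j k} → Lower a b i j k → Cond1 H a b ⊎ Cond4 H a b
    Lower⇒Cond {i} {j} L with aT a j ≟ i
    ... | no aⱼ≢i = inj₁ (i , j , D , a-at-i , aⱼ≢i , subst (LargestNbrBelow H i j) (sym b-at-i) k-below)
      where
      open Lower L
      agree : ∀ e → e ≢ eS i → AgreeAt a b e
      agree e ≢eS with e ≟ₑ eE i j
      ... | yes refl = trans (sg-minusᵗ a aⱼ≢i) (sym b-sg)
      ... | no ≢eE = lower-agree L e ≢eS ≢eE
      D : DifferExactlyAt H a b (_≡ eS i)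
      D = differExactlyAt (_≟ₑ eS i) agree λ { _ refl → lower-moves L }
    ... | yes aⱼ≡i =
      inj₂ (i , j , a-sg aⱼ≡i , b-sg , inj₁ (D , subst (LargestNbrBelow H i j) (sym b-at-i) k-below))
      where
      open Lower L
      D : DifferExactlyAt H a b (λ e → e ≡ eE i j ⊎ e ≡ eS i)
      D = differExactlyAt (either? (eE i j) (eS i)) (λ e ¬P → lower-agree L e (¬P ∘ inj₂) (¬P ∘ inj₁))
            λ { _ (inj₁ refl) → signs-differ (λ ()) (a-sg aⱼ≡i) b-sg ; _ (inj₂ refl) → lower-moves L }

    Raise⇒Cond : ∀ {i j k} → Raise a b i j k → Cond2 H a b ⊎ Cond4 H a b
    Raise⇒Cond {i} {j} U with aS a i ≟ j
    ... | no aᵢ≢j = inj₁ (i , j , D , aᵢ≢j , a-at-j , subst (SmallestNbrAbove H j i) (sym b-at-j) k-above)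
      where
      open Raise U
      agree : ∀ e → e ≢ eT j → AgreeAt a b e
      agree e ≢eT with e ≟ₑ eE i j
      ... | yes refl = trans (sg-minusˢ a aᵢ≢j) (sym b-sg)
      ... | no ≢eE = raise-agree U e ≢eT ≢eE
      D : DifferExactlyAt H a b (_≡ eT j)
      D = differExactlyAt (_≟ₑ eT j) agree λ { _ refl → raise-moves U }
    ... | yes aᵢ≡j =
      inj₂ (i , j , a-sg aᵢ≡j , b-sg , inj₂ (D , subst (SmallestNbrAbove H j i) (sym b-at-j) k-above))
      where
      open Raise U
      D : DifferExactlyAt H a b (λ e → e ≡ eE i j ⊎ e ≡ eT j)
      D = differExactlyAt (either? (eE i j) (eT j)) (λ e ¬P → raise-agree U e (¬P ∘ inj₂) (¬P ∘ inj₁))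
            λ { _ (inj₁ refl) → signs-differ (λ ()) (a-sg aᵢ≡j) b-sg ; _ (inj₂ refl) → raise-moves U }

    Flip⇒Cond3 : ∀ {i j} → Flip a b i j → Cond3 H a b
    Flip⇒Cond3 {i} {j} F = i , j , D , a-sg , b-sg
      where
      open Flip F
      D : DifferExactlyAt H a b (_≡ eE i j)
      D = differExactlyAt (_≟ₑ eE i j) (flip-agree F) λ { _ refl → signs-differ (λ ()) a-sg b-sg }

    Cond1⇒Move : Cond1 H a b → Move a b
    Cond1⇒Move (i , j , D , aᵢ≡j , aⱼ≢i , below) = lower record
      { a-at-i = aᵢ≡j ; b-at-i = refl ; k-below = below
      ; same-S = λ i' i'≢i → agree-off D (eS i') λ { refl → i'≢i refl }
      ; same-T = λ j' → agree-off D (eT j') λ ()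
      ; same-sg = λ i' j' _ → agree-off D (eE i' j') λ ()
      ; b-sg = sg-minusᵗ b λ bⱼ≡i → aⱼ≢i (trans (agree-off D (eT j) λ ()) bⱼ≡i)
      ; a-sg = λ aⱼ≡i → ⊥-elim (aⱼ≢i aⱼ≡i) }

    Cond2⇒Move : Cond2 H a b → Move a b
    Cond2⇒Move (i , j , D , aᵢ≢j , aⱼ≡i , above) = raise record
      { a-at-j = aⱼ≡i ; b-at-j = refl ; k-above = above
      ; same-S = λ i' → agree-off D (eS i') λ ()
      ; same-T = λ j' j'≢j → agree-off D (eT j') λ { refl → j'≢j refl }
      ; same-sg = λ i' j' _ → agree-off D (eE i' j') λ ()
      ; b-sg = sg-minusˢ b λ bᵢ≡j → aᵢ≢j (trans (agree-off D (eS i) λ ()) bᵢ≡j)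
      ; a-sg = λ aᵢ≡j → ⊥-elim (aᵢ≢j aᵢ≡j) }

    Cond3⇒Move : Cond3 H a b → Move a b
    Cond3⇒Move (i , j , D , sa , sb) = flip record
      { same-S = λ i' → agree-off D (eS i') λ ()
      ; same-T = λ j' → agree-off D (eT j') λ ()
      ; same-sg = λ i' j' off → agree-off D (eE i' j') λ { refl → off (refl , refl) }
      ; a-sg = sa ; b-sg = sb }

    Cond4⇒Move : Cond4 H a b → Move a b
    Cond4⇒Move (i , j , sa , sb , inj₁ (D , below)) = lower record
      { a-at-i = proj₁ (sg-ok a i j sa) ; b-at-i = refl ; k-below = below
      ; same-S = λ i' i'≢i → agree-off D (eS i') [ (λ ()) , (λ { refl → i'≢i refl }) ]′
      ; same-T = λ j' → agree-off D (eT j') [ (λ ()) , (λ ()) ]′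
      ; same-sg = λ i' j' off → agree-off D (eE i' j') [ (λ { refl → off (refl , refl) }) , (λ ()) ]′
      ; b-sg = sb ; a-sg = λ _ → sa }
    Cond4⇒Move (i , j , sa , sb , inj₂ (D , above)) = raise record
      { a-at-j = proj₂ (sg-ok a i j sa) ; b-at-j = refl ; k-above = above
      ; same-S = λ i' → agree-off D (eS i') [ (λ ()) , (λ ()) ]′
      ; same-T = λ j' j'≢j → agree-off D (eT j') [ (λ ()) , (λ { refl → j'≢j refl }) ]′
      ; same-sg = λ i' j' off → agree-off D (eE i' j') [ (λ { refl → off (refl , refl) }) , (λ ()) ]′
      ; b-sg = sb ; a-sg = λ _ → sa }

    1-excludes-2 : Cond1 H a b → ¬ Cond2 H a b
    1-excludes-2 (i , _ , D₁ , _) (_ , _ , D₂ , _) = from (D₁ (eS i)) refl (agree-off D₂ (eS i) λ ())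

    1-excludes-3 : Cond1 H a b → ¬ Cond3 H a b
    1-excludes-3 (_ , _ , D₁ , _) (i , j , D₃ , _) = from (D₃ (eE i j)) refl (agree-off D₁ (eE i j) λ ())

    1-excludes-4 : Cond1 H a b → ¬ Cond4 H a b
    1-excludes-4 (_ , _ , D₁ , _) (i , j , sa , sb , _) = signs-differ (λ ()) sa sb (agree-off D₁ (eE i j) λ ())

    2-excludes-3 : Cond2 H a b → ¬ Cond3 H a b
    2-excludes-3 (_ , _ , D₂ , _) (i , j , D₃ , _) = from (D₃ (eE i j)) refl (agree-off D₂ (eE i j) λ ())

    2-excludes-4 : Cond2 H a b → ¬ Cond4 H a b
    2-excludes-4 (_ , _ , D₂ , _) (i , j , sa , sb , _) = signs-differ (λ ()) sa sb (agree-off D₂ (eE i j) λ ())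

    3-excludes-4 : Cond3 H a b → ¬ Cond4 H a b
    3-excludes-4 (_ , _ , D₃ , _) (i , _ , _ , _ , inj₁ (D₄ , _)) =
      from (D₄ (eS i)) (inj₂ refl) (agree-off D₃ (eS i) λ ())
    3-excludes-4 (_ , _ , D₃ , _) (_ , j , _ , _ , inj₂ (D₄ , _)) =
      from (D₄ (eT j)) (inj₂ refl) (agree-off D₃ (eT j) λ ())

    AnyCond⇔ExactlyOne : AnyCond a b ⇔ ExactlyOne4 (Cond1 H a b) (Cond2 H a b) (Cond3 H a b) (Cond4 H a b)
    AnyCond⇔ExactlyOne = mk⇔ exactly-one some
      where
      exactly-one : AnyCond a b → ExactlyOne4 (Cond1 H a b) (Cond2 H a b) (Cond3 H a b) (Cond4 H a b)
      exactly-one (inj₁ c₁) = inj₁ (c₁ , 1-excludes-2 c₁ , 1-excludes-3 c₁ , 1-excludes-4 c₁)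
      exactly-one (inj₂ (inj₁ c₂)) =
        inj₂ (inj₁ ((λ c₁ → 1-excludes-2 c₁ c₂) , c₂ , 2-excludes-3 c₂ , 2-excludes-4 c₂))
      exactly-one (inj₂ (inj₂ (inj₁ c₃))) =
        inj₂ (inj₂ (inj₁ ((λ c₁ → 1-excludes-3 c₁ c₃) , (λ c₂ → 2-excludes-3 c₂ c₃) , c₃
                         , 3-excludes-4 c₃)))
      exactly-one (inj₂ (inj₂ (inj₂ c₄))) =
        inj₂ (inj₂ (inj₂ ((λ c₁ → 1-excludes-4 c₁ c₄) , (λ c₂ → 2-excludes-4 c₂ c₄)
                         , (λ c₃ → 3-excludes-4 c₃ c₄) , c₄)))
      some : ExactlyOne4 (Cond1 H a b) (Cond2 H a b) (Cond3 H a b) (Cond4 H a b) → AnyCond a b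
      some (inj₁ (c₁ , _)) = inj₁ c₁
      some (inj₂ (inj₁ (_ , c₂ , _))) = inj₂ (inj₁ c₂)
      some (inj₂ (inj₂ (inj₁ (_ , _ , c₃ , _)))) = inj₂ (inj₂ (inj₁ c₃))
      some (inj₂ (inj₂ (inj₂ (_ , _ , _ , c₄)))) = inj₂ (inj₂ (inj₂ c₄))

    Move⇔AnyCond : Move a b ⇔ AnyCond a b
    Move⇔AnyCond = mk⇔ toCond fromCond
      where
      toCond : Move a b → AnyCond a b
      toCond (lower L) = [ inj₁ , (inj₂ ∘ inj₂ ∘ inj₂) ]′ (Lower⇒Cond L)
      toCond (raise U) = [ inj₂ ∘ inj₁ , (inj₂ ∘ inj₂ ∘ inj₂) ]′ (Raise⇒Cond U)
      toCond (flip F) = inj₂ (inj₂ (inj₁ (Flip⇒Cond3 F)))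
      fromCond : AnyCond a b → Move a b
      fromCond = [ Cond1⇒Move , [ Cond2⇒Move , [ Cond3⇒Move , Cond4⇒Move ]′ ]′ ]′

proposition4p4 : (H : BipGraph) → NoSmallDegree H →
    (a b : CliqueVector H) →
    (_⋖_ H (φ H a) (φ H b)) ⇔
    ExactlyOne4 (Cond1 H a b) (Cond2 H a b) (Cond3 H a b) (Cond4 H a b)
proposition4p4 H _ a b = AnyCond⇔ExactlyOne ⇔-∘ (Move⇔AnyCond ⇔-∘ ⋖⇔Move a b)
  where
  open Moves H
  open Conditions H
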